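{- For $s \ge 1$ let \[ \bar a^{\mathrm{ref}}_s(t) = \sum_{k \ge 0} \bar a_{s,k} t^k, \] where $\bar a_{s,k}$ is the number of isomorphism classes of rooted series-reduced trees with $s$ unlabeled leaves and $k$ inner vertices. Then $\bar a^{\mathrm{ref}}_1(t) = 1$, and for $s > 1$, \[ \bar a^{\mathrm{ref}}_s(t) = \frac{t}{s!} \sum_{j=1}^{s} B_{s,j}\!\left( \left\{ n! \sum_{\substack{d \mid n \\ n/d \neq s}} \frac{1}{d}\, \bar a^{\mathrm{ref}}_{n/d}\big(t^d\big) \right\}_{n=1}^{s-j+1} \right). \]
   Context: A rooted tree is series-reduced if no vertex has out-degree $1$. Leaves are the vertices of out-degree $0$, and inner vertices are all others; the single vertex is the unique tree with $1$ leaf and $0$ inner vertices. Trees are non-planar and are counted up to root-preserving isomorphism. $B_{n,j}(x_1,\dots,x_{n-j+1})$ denotes the partial exponential Bell polynomial \[ \sum \frac{n!}{\prod_i \alpha_i!}\prod_i (x_i/i!)^{\alpha_i}, \] the sum over nonnegative integers $\alpha_i$ with $\sum_i \alpha_i = j$ and $\sum_i i\,\alpha_i = n$. The notation $\{z_n\}_{n=1}^{N}$ denotes the argument list $(z_1,\dots,z_N)$. -}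

module Defs where

open import Data.Nat as ℕ using (ℕ; zero; suc; _∸_; _!; _≡ᵇ_)
open import Data.Nat.Properties using (_!≢0)
open import Data.Nat.Divisibility using (_∣?_)
open import Data.Nat.DivMod using (_/_)
open import Data.Integer using (+_)
open import Data.Rational as ℚ using (ℚ; 0ℚ; 1ℚ; _+_; _*_)
open import Data.List using (List; []; _∷_; map; foldr; upTo; concatMap)
open import Data.List.Relation.Binary.Permutation.Propositional using (_↭_)
open import Data.List.Relation.Binary.Pointwise using (Pointwise)
open import Data.List.Relation.Unary.All using (All)
open import Data.Vec using (Vec; lookup)
open import Data.Fin using (Fin)
open import Data.Bool using (Bool; if_then_else_; _∧_; not)
open import Data.Product using (Σ; _×_)
open import Data.Unit using (⊤)
open import Data.Empty using (⊥)
open import Relation.Nullary using (does)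
open import Relation.Binary.PropositionalEquality using (_≡_)

-- A rooted tree: a root with a (finite) list of child subtrees.
-- The order of children is irrelevant up to the isomorphism _≅_ below.
data Tree : Set where
  node : List Tree → Tree

data _≅_ : Tree → Tree → Set where
  node : ∀ {xs ys zs} → xs ↭ zs → Pointwise _≅_ zs ys → node xs ≅ node ys

mutual
  leaves : Tree → ℕ
  leaves (node []) = 1
  leaves (node (x ∷ xs)) = leavesL (x ∷ xs)

  leavesL : List Tree → ℕ
  leavesL [] = 0
  leavesL (x ∷ xs) = leaves x ℕ.+ leavesL xs

mutual
  inner : Tree → ℕ
  inner (node []) = 0
  inner (node (x ∷ xs)) = suc (innerL (x ∷ xs))

  innerL : List Tree → ℕ
  innerL [] = 0
  innerL (x ∷ xs) = inner x ℕ.+ innerL xs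

mutual
  SeriesReduced : Tree → Set
  SeriesReduced (node []) = ⊤
  SeriesReduced (node (x ∷ [])) = ⊥
  SeriesReduced (node (x ∷ y ∷ xs)) = SeriesReducedL (x ∷ y ∷ xs)

  SeriesReducedL : List Tree → Set
  SeriesReducedL [] = ⊤
  SeriesReducedL (x ∷ xs) = SeriesReduced x × SeriesReducedL xs

Good : ℕ → ℕ → Tree → Set
Good s k t = SeriesReduced t × (leaves t ≡ s) × (inner t ≡ k)

-- "the number of isomorphism classes of Good s k trees is n":
-- there are n pairwise non-isomorphic representatives covering all classes.
IsoClassCount : ℕ → ℕ → ℕ → Set
IsoClassCount s k n =
  Σ (Vec Tree n) λ v →
    ((i : Fin n) → Good s k (lookup v i)) ×
    ((i j : Fin n) → lookup v i ≅ lookup v j → i ≡ j) ×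
    ((t : Tree) → Good s k t → Σ (Fin n) λ i → t ≅ lookup v i)

PS : Set
PS = ℕ → ℚ

fromℕ : ℕ → ℚ
fromℕ n = (+ n) ℚ./ 1

invFact : ℕ → ℚ
invFact m = ((+ 1) ℚ./ (m !)) {{m !≢0}}

sumℚ : List ℚ → ℚ
sumℚ = foldr _+_ 0ℚ

zeroPS : PS
zeroPS _ = 0ℚ

onePS : PS
onePS zero = 1ℚ
onePS (suc _) = 0ℚ

tPS : PS
tPS zero = 0ℚ
tPS (suc zero) = 1ℚ
tPS (suc (suc _)) = 0ℚ

_⊕_ : PS → PS → PS
(f ⊕ g) m = f m + g m

scale : ℚ → PS → PS
scale c f m = c * f m

_⊗_ : PS → PS → PS
(f ⊗ g) m = sumℚ (map (λ i → f i * g (m ∸ i)) (upTo (suc m)))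

pow : PS → ℕ → PS
pow f zero = onePS
pow f (suc n) = f ⊗ pow f n

sumPS : List PS → PS
sumPS = foldr _⊕_ zeroPS

-- f(t^(e+1))
substPow : ℕ → PS → PS
substPow e f m = if does (suc e ∣? m) then f (m / suc e) else 0ℚ

-- Partial exponential Bell polynomial B_{n,j}(x_1,...,x_{n-j+1})
-- with power-series arguments x i (i ≥ 1; x 0 is never used).

tuples : ℕ → ℕ → List (List ℕ)
tuples zero b = [] ∷ []
tuples (suc N) b = concatMap (λ a → map (a ∷_) (tuples N b)) (upTo (suc b))

sumℕ : List ℕ → ℕ
sumℕ = foldr ℕ._+_ 0

wsum : ℕ → List ℕ → ℕ
wsum i [] = 0
wsum i (a ∷ as) = i ℕ.* a ℕ.+ wsum (suc i) as

bellCoeff : ℕ → List ℕ → ℚ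
bellCoeff n α = fromℕ (n !) * foldr (λ a r → invFact a * r) 1ℚ α

bellProd : (ℕ → PS) → ℕ → List ℕ → PS
bellProd x i [] = onePS
bellProd x i (a ∷ as) = pow (scale (invFact i) (x i)) a ⊗ bellProd x (suc i) as

Bell : ℕ → ℕ → (ℕ → PS) → PS
Bell n j x =
  sumPS (map (λ α → if (sumℕ α ≡ᵇ j) ∧ (wsum 1 α ≡ᵇ n)
                      then scale (bellCoeff n α) (bellProd x 1 α)
                      else zeroPS)
             (tuples (suc (n ∸ j)) j))

abar : (ℕ → ℕ → ℕ) → ℕ → PS
abar a s k = fromℕ (a s k)

-- n! Σ_{d | n, n/d ≠ s} (1/d) ā_{n/d}(t^d)   (d = e + 1 ranges over 1..n)
bellArg : (ℕ → ℕ → ℕ) → ℕ → ℕ → PS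
bellArg a s n =
  scale (fromℕ (n !))
    (sumPS (map (λ e → if does (suc e ∣? n) ∧ not ((n / suc e) ≡ᵇ s)
                         then scale ((+ 1) ℚ./ suc e) (substPow e (abar a (n / suc e)))
                         else zeroPS)
                (upTo n)))

recRHS : (ℕ → ℕ → ℕ) → ℕ → PS
recRHS a s =
  tPS ⊗ scale (invFact s) (sumPS (map (λ j → Bell s j (bellArg a s)) (map suc (upTo s))))

-- Fix K and work over 𝔸 = ℚ[t]/(t^(K+1)). A series-reduced tree with s ≥ 2 leaves is a root above a
-- multiset of at least two trees with fewer leaves, so ā_s(t) = t · [x^s] F for
-- F = ∏_r 1/(1 - t^(inner r) x^(leaves r)), the product over representatives r with fewer than s leaves.
-- With θ = x d/dx, F satisfies θF = F·L for L = θ log F = Σ_i i y_i x^i, where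
-- y_i = Σ_{d ∣ i, i/d ≠ s} ā_{i/d}(t^d)/d. So does ∏_i exp(y_i x^i); both start with 1, hence they agree.
-- Expanding the exponentials, [x^s] ∏_i exp(y_i x^i) = Σ_{Σ i α_i = s} ∏_i y_i^(α_i)/α_i!
-- = (1/s!) Σ_j B_{s,j}(1! y_1, 2! y_2, …).

module Submission where

open import Defs
open import Algebra.Bundles using (CommutativeSemiring; CommutativeRing; CommutativeMonoid)
open import Data.Bool as Bool using (Bool; true; false; if_then_else_; _∧_; not)
import Data.Bool.Properties as Boolₚ
open import Data.Empty using (⊥)
open import Data.List using (List; []; _∷_; _++_; map; foldr; applyUpTo; upTo; concatMap; replicate; length; filter; lookup)
import Data.List.Properties as Listₚ
open import Data.List.Membership.Propositional using (_∈_; find; lose)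
import Data.List.Membership.Propositional.Properties as ∈ₚ
open import Data.List.Relation.Binary.Permutation.Propositional as ↭ using (_↭_; ↭-sym)
import Data.List.Relation.Binary.Permutation.Propositional.Properties as ↭ₚ
open import Data.List.Relation.Binary.Pointwise using (Pointwise; []; _∷_)
open import Data.List.Relation.Unary.All using (All; []; _∷_)
import Data.List.Relation.Unary.All as All
import Data.List.Relation.Unary.All.Properties as Allₚ
open import Data.List.Relation.Unary.Any using (here; there)
import Data.List.Relation.Unary.Any as Any
import Data.List.Relation.Unary.Any.Properties as Anyₚ
open import Data.List.Relation.Unary.AllPairs using ([]; _∷_)
open import Data.List.Relation.Unary.Unique.Propositional using (Unique)
import Data.List.Relation.Unary.Unique.Propositional.Properties as Uniqueₚ
open import Data.Nat as ℕ using (ℕ; zero; suc; _≤_; _<_; z≤n; s≤s; _∸_; _≡ᵇ_; _≤ᵇ_; _<ᵇ_; _!)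
import Data.Nat.Properties as ℕₚ
open import Data.Nat.Divisibility using (_∣_; divides; _∣?_; ∣⇒≤)
open import Data.Nat.DivMod as DivMod using (_/_; _divMod_; result)
open import Data.Nat.Tactic.RingSolver using (solve-∀)
open import Data.Product using (Σ; ∃; _×_; _,_; proj₁; proj₂)
open import Data.Rational as ℚ using (ℚ; 0ℚ; 1ℚ; toℚᵘ)
import Data.Rational.Properties as ℚₚ
open import Data.Unit using (tt)
import Data.Vec as Vec
open import Function using (_∘_)
open import Level using (0ℓ; _⊔_)
open import Relation.Binary.PropositionalEquality as ≡ using (_≡_; _≢_)
open import Relation.Nullary using (Dec; yes; no; ¬_; does; contradiction)
open import Relation.Nullary.Decidable using (dec-true; dec-false)
open import Algebra.Properties.CommutativeSemigroup (CommutativeMonoid.commutativeSemigroup Boolₚ.∧-commutativeMonoid)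
  using () renaming (interchange to ∧-interchange)

≤ᵇ-suc : ∀ m n → (suc m ≤ᵇ suc n) ≡ (m ≤ᵇ n)
≤ᵇ-suc zero n = ≡.refl
≤ᵇ-suc (suc m) n = ≡.refl

≤ᵇ-true : ∀ {m n} → m ≤ n → (m ≤ᵇ n) ≡ true
≤ᵇ-true = dec-true (_ ℕ.≤? _)

≤ᵇ-false : ∀ {m n} → n < m → (m ≤ᵇ n) ≡ false
≤ᵇ-false n<m = dec-false (_ ℕ.≤? _) (ℕₚ.<⇒≱ n<m)

≤ᵇ-true⁻ : ∀ {m n} → (m ≤ᵇ n) ≡ true → m ≤ n
≤ᵇ-true⁻ {m} {n} e = ℕₚ.≤ᵇ⇒≤ m n (≡.subst Bool.T (≡.sym e) _)

≡ᵇ-true : ∀ {m n} → m ≡ n → (m ≡ᵇ n) ≡ true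
≡ᵇ-true = dec-true (_ ℕ.≟ _)

≡ᵇ-false : ∀ {m n} → m ≢ n → (m ≡ᵇ n) ≡ false
≡ᵇ-false = dec-false (_ ℕ.≟ _)

≡ᵇ-true⁻ : ∀ {m n} → (m ≡ᵇ n) ≡ true → m ≡ n
≡ᵇ-true⁻ {m} {n} e = ℕₚ.≡ᵇ⇒≡ m n (≡.subst Bool.T (≡.sym e) _)

∧-true⁻ : ∀ {x y} → (x ∧ y) ≡ true → (x ≡ true) × (y ≡ true)
∧-true⁻ {true} y≡true = ≡.refl , y≡true

<ᵇ≡not≡ᵇ : ∀ {m n} → m ≤ n → (m ℕ.<ᵇ n) ≡ not (m ≡ᵇ n)
<ᵇ≡not≡ᵇ {m} {n} m≤n with m ℕ.≟ n
... | yes ≡.refl = ≡.trans (≤ᵇ-false (ℕₚ.n<1+n m)) (≡.cong not (≡.sym (≡ᵇ-true {m} ≡.refl)))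
... | no m≢n = ≡.trans (≤ᵇ-true (ℕₚ.≤∧≢⇒< m≤n m≢n)) (≡.cong not (≡.sym (≡ᵇ-false m≢n)))

+-≡ᵇ : ∀ a x j → (a ℕ.+ x ≡ᵇ j) ≡ ((a ≤ᵇ j) ∧ (x ≡ᵇ j ∸ a))
+-≡ᵇ zero x j = ≡.refl
+-≡ᵇ (suc a) x zero = ≡.refl
+-≡ᵇ (suc a) x (suc j) = ≡.trans (+-≡ᵇ a x j) (≡.cong (_∧ (x ≡ᵇ j ∸ a)) (≡.sym (≤ᵇ-suc a j)))

≡ᵇ-comm : ∀ m n → (m ≡ᵇ n) ≡ (n ≡ᵇ m)
≡ᵇ-comm zero zero = ≡.refl
≡ᵇ-comm zero (suc n) = ≡.refl
≡ᵇ-comm (suc m) zero = ≡.refl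
≡ᵇ-comm (suc m) (suc n) = ≡ᵇ-comm m n

≡ᵇ-*-nondivisor : ∀ d {n} x → ¬ (suc d ∣ n) → (n ≡ᵇ suc d ℕ.* x) ≡ false
≡ᵇ-*-nondivisor d x ∤n = ≡ᵇ-false λ n≡ → ∤n (divides x (≡.trans n≡ (ℕₚ.*-comm (suc d) x)))

≡ᵇ-*-divisor : ∀ d {n} x → suc d ∣ n → (n ≡ᵇ suc d ℕ.* x) ≡ (x ≡ᵇ n / suc d)
≡ᵇ-*-divisor d x (divides c ≡.refl) with x ℕ.≟ c
... | yes ≡.refl = ≡.trans (≡ᵇ-true (ℕₚ.*-comm x (suc d)))
  (≡.sym (≡.trans (≡.cong (x ≡ᵇ_) (DivMod.m*n/n≡m x (suc d))) (≡ᵇ-true {x} ≡.refl)))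
... | no x≢c = ≡.trans (≡ᵇ-false λ e → x≢c (≡.sym (ℕₚ.*-cancelʳ-≡ c x (suc d) (≡.trans e (ℕₚ.*-comm (suc d) x)))))
  (≡.sym (≡.trans (≡.cong (x ≡ᵇ_) (DivMod.m*n/n≡m c (suc d))) (≡ᵇ-false x≢c)))

r+a*m∸b*m≡r+[a∸b]*m : ∀ r a b m → b ≤ a → r ℕ.+ a ℕ.* m ∸ b ℕ.* m ≡ r ℕ.+ (a ∸ b) ℕ.* m
r+a*m∸b*m≡r+[a∸b]*m r a b m b≤a = begin
  r ℕ.+ a ℕ.* m ∸ b ℕ.* m                     ≡⟨ ≡.cong (λ z → r ℕ.+ z ℕ.* m ∸ b ℕ.* m) (≡.sym (ℕₚ.m∸n+n≡m b≤a)) ⟩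
  r ℕ.+ (a ∸ b ℕ.+ b) ℕ.* m ∸ b ℕ.* m         ≡⟨ ≡.cong (λ z → r ℕ.+ z ∸ b ℕ.* m) (ℕₚ.*-distribʳ-+ m (a ∸ b) b) ⟩
  r ℕ.+ ((a ∸ b) ℕ.* m ℕ.+ b ℕ.* m) ∸ b ℕ.* m ≡⟨ ≡.cong (_∸ b ℕ.* m) (≡.sym (ℕₚ.+-assoc r _ _)) ⟩
  r ℕ.+ (a ∸ b) ℕ.* m ℕ.+ b ℕ.* m ∸ b ℕ.* m   ≡⟨ ℕₚ.m+n∸n≡m _ (b ℕ.* m) ⟩
  r ℕ.+ (a ∸ b) ℕ.* m                         ∎
  where open ≡.≡-Reasoning

b*m≤r+a*m⇒b≤a : ∀ {r a b m} → r < m → b ℕ.* m ≤ r ℕ.+ a ℕ.* m → b ≤ a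
b*m≤r+a*m⇒b≤a {r} {a} {b} {m} r<m b*m≤ with b ℕ.≤? a
... | yes b≤a = b≤a
... | no b≰a = contradiction b*m≤ (ℕₚ.<⇒≱ (ℕₚ.<-≤-trans (ℕₚ.+-monoˡ-< (a ℕ.* m) r<m) (ℕₚ.*-monoˡ-≤ m (ℕₚ.≰⇒> b≰a))))

n∸i*a<[1+i]*[j∸a]+N : ∀ {i j a n N} → a < j → i ℕ.* a ≤ n → n < i ℕ.* j ℕ.+ suc N →
                      n ∸ i ℕ.* a < suc i ℕ.* (j ∸ a) ℕ.+ N
n∸i*a<[1+i]*[j∸a]+N {i} {j} {a} {n} {N} a<j ia≤n n< = begin-strict
  n ∸ i ℕ.* a                                 <⟨ ℕₚ.∸-monoˡ-< n< ia≤n ⟩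
  i ℕ.* j ℕ.+ suc N ∸ i ℕ.* a                 ≡⟨ ≡.cong (λ z → z ℕ.+ suc N ∸ i ℕ.* a) i*j ⟩
  i ℕ.* a ℕ.+ i ℕ.* d ℕ.+ suc N ∸ i ℕ.* a     ≡⟨ ≡.cong (_∸ i ℕ.* a) (ℕₚ.+-assoc (i ℕ.* a) (i ℕ.* d) (suc N)) ⟩
  i ℕ.* a ℕ.+ (i ℕ.* d ℕ.+ suc N) ∸ i ℕ.* a   ≡⟨ ℕₚ.m+n∸m≡n (i ℕ.* a) _ ⟩
  i ℕ.* d ℕ.+ suc N                           ≡⟨ ℕₚ.+-suc (i ℕ.* d) N ⟩
  suc (i ℕ.* d ℕ.+ N)                         ≤⟨ ℕₚ.+-monoˡ-≤ (i ℕ.* d ℕ.+ N) (ℕₚ.m<n⇒0<n∸m a<j) ⟩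
  d ℕ.+ (i ℕ.* d ℕ.+ N)                       ≡⟨ ℕₚ.+-assoc d (i ℕ.* d) N ⟨
  suc i ℕ.* d ℕ.+ N                           ∎
  where
  open ℕₚ.≤-Reasoning
  d = j ∸ a
  i*j : i ℕ.* j ≡ i ℕ.* a ℕ.+ i ℕ.* d
  i*j = ≡.trans (≡.cong (i ℕ.*_) (≡.sym (ℕₚ.m+[n∸m]≡n (ℕₚ.<⇒≤ a<j)))) (ℕₚ.*-distribˡ-+ i a d)

1≤quotient : ∀ {d i} → 1 ≤ i → suc d ∣ i → 1 ≤ i / suc d
1≤quotient {d} 1≤i (divides zero ≡.refl) = contradiction 1≤i λ ()
1≤quotient {d} _ (divides (suc c) ≡.refl) = ≡.subst (1 ≤_) (≡.sym (DivMod.m*n/n≡m (suc c) (suc d))) (s≤s z≤n)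

module SemiringSums {c ℓ} (R : CommutativeSemiring c ℓ) where

  open CommutativeSemiring R
  open import Relation.Binary.Reasoning.Setoid setoid
  open import Algebra.Properties.CommutativeSemigroup +-commutativeSemigroup using (interchange)
  import Algebra.Properties.Semiring.Mult semiring as Mult

  when : Bool → Carrier → Carrier
  when b x = if b then x else 0#

  when-≤ᵇ-suc : ∀ m n x → when (suc m ≤ᵇ suc n) x ≈ when (m ≤ᵇ n) x
  when-≤ᵇ-suc m n x = reflexive (≡.cong (λ b → when b x) (≤ᵇ-suc m n))

  when-cong : ∀ b {x y} → (b ≡ true → x ≈ y) → when b x ≈ when b y
  when-cong true e = e ≡.refl
  when-cong false e = refl

  when-vanish : ∀ b {x} → (b ≡ true → x ≈ 0#) → when b x ≈ 0#
  when-vanish true e = e ≡.refl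
  when-vanish false e = refl

  *-when : ∀ b x y → x * when b y ≈ when b (x * y)
  *-when true x y = refl
  *-when false x y = zeroʳ x

  when-∧ : ∀ b c x → when (b ∧ c) x ≡ when b (when c x)
  when-∧ true c x = ≡.refl
  when-∧ false c x = ≡.refl

  ι : ℕ → Carrier
  ι n = n Mult.× 1#

  Σ< : ℕ → (ℕ → Carrier) → Carrier
  Σ< zero f = 0#
  Σ< (suc n) f = f 0 + Σ< n (f ∘ suc)

  Σ<-cong : ∀ n {f g} → (∀ i → i < n → f i ≈ g i) → Σ< n f ≈ Σ< n g
  Σ<-cong zero e = refl
  Σ<-cong (suc n) e = +-cong (e 0 (s≤s z≤n)) (Σ<-cong n (λ i i<n → e (suc i) (s≤s i<n)))

  Σ<-zero : ∀ n {f} → (∀ i → i < n → f i ≈ 0#) → Σ< n f ≈ 0#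
  Σ<-zero zero e = refl
  Σ<-zero (suc n) e =
    trans (+-cong (e 0 (s≤s z≤n)) (Σ<-zero n (λ i i<n → e (suc i) (s≤s i<n)))) (+-identityʳ 0#)

  Σ<-+ : ∀ n f g → Σ< n (λ i → f i + g i) ≈ Σ< n f + Σ< n g
  Σ<-+ zero f g = sym (+-identityʳ 0#)
  Σ<-+ (suc n) f g = trans (+-congˡ (Σ<-+ n (f ∘ suc) (g ∘ suc))) (interchange _ _ _ _)

  Σ<-*ˡ : ∀ n a f → a * Σ< n f ≈ Σ< n (λ i → a * f i)
  Σ<-*ˡ zero a f = zeroʳ a
  Σ<-*ˡ (suc n) a f = trans (distribˡ _ _ _) (+-congˡ (Σ<-*ˡ n a (f ∘ suc)))

  Σ<-when : ∀ n b f → Σ< n (λ i → when b (f i)) ≈ when b (Σ< n f)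
  Σ<-when n true f = refl
  Σ<-when n false f = Σ<-zero n (λ _ _ → refl)

  Σ<-truncate : ∀ m n f → m ≤ n → (∀ i → m ≤ i → i < n → f i ≈ 0#) → Σ< n f ≈ Σ< m f
  Σ<-truncate zero n f _ e = Σ<-zero n (λ i → e i z≤n)
  Σ<-truncate (suc m) (suc n) f (s≤s m≤n) e =
    +-congˡ (Σ<-truncate m n (f ∘ suc) m≤n (λ i m≤i i<n → e (suc i) (s≤s m≤i) (s≤s i<n)))

  Σ<-delta : ∀ n c (f : ℕ → Carrier) → Σ< n (λ i → when (i ≡ᵇ c) (f i)) ≈ when (c <ᵇ n) (f c)
  Σ<-delta zero c f = refl
  Σ<-delta (suc n) zero f = trans (+-congˡ (Σ<-zero n (λ _ _ → refl))) (+-identityʳ _)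
  Σ<-delta (suc n) (suc c) f = trans (+-identityˡ _) (Σ<-delta n c (f ∘ suc))

  Σ<-count : ∀ n a x → a ≤ n → Σ< n (λ i → when (i <ᵇ a) x) ≈ ι a * x
  Σ<-count n zero x _ = trans (Σ<-zero n (λ _ _ → refl)) (sym (zeroˡ x))
  Σ<-count (suc n) (suc a) x (s≤s a≤n) = begin
    x + Σ< n (λ i → when (i <ᵇ a) x) ≈⟨ +-congˡ (Σ<-count n a x a≤n) ⟩
    x + ι a * x                      ≈⟨ +-congʳ (sym (*-identityˡ x)) ⟩
    1# * x + ι a * x                 ≈⟨ sym (distribʳ x 1# (ι a)) ⟩
    ι (suc a) * x                    ∎

  listSum : List Carrier → Carrier
  listSum = foldr _+_ 0#

  listSum-applyUpTo : ∀ n (h : ℕ → Carrier) g → listSum (map h (applyUpTo g n)) ≈ Σ< n (h ∘ g)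
  listSum-applyUpTo zero h g = refl
  listSum-applyUpTo (suc n) h g = +-congˡ (listSum-applyUpTo n h (g ∘ suc))

  listSum-++ : ∀ xs ys → listSum (xs ++ ys) ≈ listSum xs + listSum ys
  listSum-++ [] ys = sym (+-identityˡ _)
  listSum-++ (x ∷ xs) ys = trans (+-congˡ (listSum-++ xs ys)) (sym (+-assoc x _ _))

  listSum-cong : ∀ {A : Set} {G G′ : A → Carrier} xs → (∀ a → G a ≈ G′ a) → listSum (map G xs) ≈ listSum (map G′ xs)
  listSum-cong [] e = refl
  listSum-cong (a ∷ xs) e = +-cong (e a) (listSum-cong xs e)

  listSum-zero : ∀ {A : Set} (G : A → Carrier) xs → (∀ a → G a ≈ 0#) → listSum (map G xs) ≈ 0#
  listSum-zero G [] e = refl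
  listSum-zero G (a ∷ xs) e = trans (+-cong (e a) (listSum-zero G xs e)) (+-identityʳ 0#)

  listSum-+ : ∀ {A : Set} (G H : A → Carrier) xs → listSum (map (λ a → G a + H a) xs) ≈ listSum (map G xs) + listSum (map H xs)
  listSum-+ G H [] = sym (+-identityʳ 0#)
  listSum-+ G H (a ∷ xs) = trans (+-congˡ (listSum-+ G H xs)) (interchange _ _ _ _)

  listSum-*ˡ : ∀ {A : Set} x (G : A → Carrier) xs → x * listSum (map G xs) ≈ listSum (map (λ a → x * G a) xs)
  listSum-*ˡ x G [] = zeroʳ x
  listSum-*ˡ x G (a ∷ xs) = trans (distribˡ x _ _) (+-congˡ (listSum-*ˡ x G xs))

  listSum-swap : ∀ {A B : Set} (G : A → B → Carrier) xs ys →
    listSum (map (λ a → listSum (map (G a) ys)) xs) ≈ listSum (map (λ b → listSum (map (λ a → G a b) xs)) ys)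
  listSum-swap G [] ys = sym (listSum-zero _ ys (λ _ → refl))
  listSum-swap G (a ∷ xs) ys = trans (+-congˡ (listSum-swap G xs ys)) (sym (listSum-+ (G a) _ ys))

  listSum-concatMap : ∀ {A B : Set} (G : B → Carrier) (h : A → List B) xs →
    listSum (map G (concatMap h xs)) ≈ listSum (map (λ a → listSum (map G (h a))) xs)
  listSum-concatMap G h [] = refl
  listSum-concatMap G h (a ∷ xs) = begin
    listSum (map G (h a ++ concatMap h xs))              ≡⟨ ≡.cong listSum (Listₚ.map-++ G (h a) (concatMap h xs)) ⟩
    listSum (map G (h a) ++ map G (concatMap h xs))      ≈⟨ listSum-++ (map G (h a)) _ ⟩
    listSum (map G (h a)) + listSum (map G (concatMap h xs)) ≈⟨ +-congˡ (listSum-concatMap G h xs) ⟩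
    listSum (map (λ a → listSum (map G (h a))) (a ∷ xs)) ∎

module ℕΣ = SemiringSums ℕₚ.+-*-commutativeSemiring

module PowerSeries {c ℓ} (R : CommutativeSemiring c ℓ) where

  open CommutativeSemiring R
  open SemiringSums R
  open import Relation.Binary.Reasoning.Setoid setoid
  open import Algebra.Solver.Ring.NaturalCoefficients.Default R
  open import Algebra.Properties.CommutativeSemigroup +-commutativeSemigroup using (interchange)

  Series : Set c
  Series = ℕ → Carrier

  shift : Series → Series
  shift f = f ∘ suc

  infixl 6 _⊞_
  infixl 7 _⊠_ _•_
  infix 4 _≐_

  _⊞_ : Series → Series → Series
  (f ⊞ g) n = f n + g n

  _⊠_ : Series → Series → Series
  (f ⊠ g) zero = f 0 * g 0
  (f ⊠ g) (suc n) = f 0 * g (suc n) + (shift f ⊠ g) n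

  _•_ : Carrier → Series → Series
  (a • f) n = a * f n

  𝟘 : Series
  𝟘 _ = 0#

  𝟙 : Series
  𝟙 zero = 1#
  𝟙 (suc _) = 0#

  _≐_ : Series → Series → Set ℓ
  f ≐ g = ∀ n → f n ≈ g n

  ⊠-cong-≤ : ∀ n {f f′ g g′} → (∀ i → i ≤ n → f i ≈ f′ i) → (∀ i → i ≤ n → g i ≈ g′ i) →
             (f ⊠ g) n ≈ (f′ ⊠ g′) n
  ⊠-cong-≤ zero ef eg = *-cong (ef 0 z≤n) (eg 0 z≤n)
  ⊠-cong-≤ (suc n) ef eg = +-cong (*-cong (ef 0 z≤n) (eg (suc n) ℕₚ.≤-refl))
    (⊠-cong-≤ n (λ i i≤n → ef (suc i) (s≤s i≤n)) (λ i i≤n → eg i (ℕₚ.m≤n⇒m≤1+n i≤n)))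

  ⊠-cong : ∀ {f f′ g g′} → f ≐ f′ → g ≐ g′ → f ⊠ g ≐ f′ ⊠ g′
  ⊠-cong ef eg n = ⊠-cong-≤ n (λ i _ → ef i) (λ i _ → eg i)

  ⊠-zeroˡ : ∀ f → 𝟘 ⊠ f ≐ 𝟘
  ⊠-zeroˡ f zero = zeroˡ _
  ⊠-zeroˡ f (suc n) = trans (+-cong (zeroˡ _) (⊠-zeroˡ f n)) (+-identityˡ _)

  ⊠-identityˡ : ∀ f → 𝟙 ⊠ f ≐ f
  ⊠-identityˡ f zero = *-identityˡ _
  ⊠-identityˡ f (suc n) = trans (+-cong (*-identityˡ _) (⊠-zeroˡ f n)) (+-identityʳ _)

  ⊠-distribʳ : ∀ f g h → (f ⊞ g) ⊠ h ≐ f ⊠ h ⊞ g ⊠ h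
  ⊠-distribʳ f g h zero = distribʳ _ _ _
  ⊠-distribʳ f g h (suc n) = begin
    (f 0 + g 0) * h (suc n) + ((shift f ⊞ shift g) ⊠ h) n
      ≈⟨ +-cong (distribʳ _ _ _) (⊠-distribʳ (shift f) (shift g) h n) ⟩
    (f 0 * h (suc n) + g 0 * h (suc n)) + ((shift f ⊠ h) n + (shift g ⊠ h) n)
      ≈⟨ interchange _ _ _ _ ⟩
    (f ⊠ h) (suc n) + (g ⊠ h) (suc n) ∎

  ⊠-scalarˡ : ∀ a f g → (a • f) ⊠ g ≐ a • (f ⊠ g)
  ⊠-scalarˡ a f g zero = *-assoc _ _ _
  ⊠-scalarˡ a f g (suc n) = begin
    (a * f 0) * g (suc n) + ((a • shift f) ⊠ g) n ≈⟨ +-cong (*-assoc _ _ _) (⊠-scalarˡ a (shift f) g n) ⟩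
    a * (f 0 * g (suc n)) + a * (shift f ⊠ g) n   ≈⟨ sym (distribˡ _ _ _) ⟩
    a * (f ⊠ g) (suc n)                           ∎

  ⊠-comm : ∀ f g → f ⊠ g ≐ g ⊠ f
  ⊠-comm f g zero = *-comm _ _
  ⊠-comm f g (suc zero) =
    solve 4 (λ a b c d → a :* b :+ c :* d := d :* c :+ b :* a) refl (f 0) (g 1) (f 1) (g 0)
  ⊠-comm f g (suc (suc n)) = begin
    f 0 * g (suc (suc n)) + (shift f ⊠ g) (suc n)
      ≈⟨ +-congˡ (⊠-comm (shift f) g (suc n)) ⟩
    f 0 * g (suc (suc n)) + (g 0 * f (suc (suc n)) + (shift g ⊠ shift f) n)
      ≈⟨ +-congˡ (+-congˡ (⊠-comm (shift g) (shift f) n)) ⟩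
    f 0 * g (suc (suc n)) + (g 0 * f (suc (suc n)) + (shift f ⊠ shift g) n)
      ≈⟨ solve 3 (λ a b c → a :+ (b :+ c) := b :+ (a :+ c)) refl _ _ _ ⟩
    g 0 * f (suc (suc n)) + (f ⊠ shift g) (suc n)
      ≈⟨ +-congˡ (⊠-comm f (shift g) (suc n)) ⟩
    g 0 * f (suc (suc n)) + (shift g ⊠ f) (suc n) ∎

  ⊠-assoc : ∀ f g h → (f ⊠ g) ⊠ h ≐ f ⊠ (g ⊠ h)
  ⊠-assoc f g h zero = *-assoc _ _ _
  ⊠-assoc f g h (suc n) = begin
    (f 0 * g 0) * h (suc n) + (((f 0 • shift g) ⊞ (shift f ⊠ g)) ⊠ h) n
      ≈⟨ +-congˡ (⊠-distribʳ (f 0 • shift g) (shift f ⊠ g) h n) ⟩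
    (f 0 * g 0) * h (suc n) + (((f 0 • shift g) ⊠ h) n + ((shift f ⊠ g) ⊠ h) n)
      ≈⟨ +-congˡ (+-cong (⊠-scalarˡ (f 0) (shift g) h n) (⊠-assoc (shift f) g h n)) ⟩
    (f 0 * g 0) * h (suc n) + (f 0 * (shift g ⊠ h) n + (shift f ⊠ (g ⊠ h)) n)
      ≈⟨ solve 5 (λ a b c x y → (a :* b) :* c :+ (a :* x :+ y) := a :* (b :* c :+ x) :+ y) refl _ _ _ _ _ ⟩
    (f ⊠ (g ⊠ h)) (suc n) ∎

  ⊠-distribˡ : ∀ f g h → f ⊠ (g ⊞ h) ≐ f ⊠ g ⊞ f ⊠ h
  ⊠-distribˡ f g h n = trans (⊠-comm f (g ⊞ h) n)
    (trans (⊠-distribʳ g h f n) (+-cong (⊠-comm g f n) (⊠-comm h f n)))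

  ⊠-identityʳ : ∀ f → f ⊠ 𝟙 ≐ f
  ⊠-identityʳ f n = trans (⊠-comm f 𝟙 n) (⊠-identityˡ f n)

  ⊠-zeroʳ : ∀ f → f ⊠ 𝟘 ≐ 𝟘
  ⊠-zeroʳ f n = trans (⊠-comm f 𝟘 n) (⊠-zeroˡ f n)

  ⊠-scalarʳ : ∀ a f g → f ⊠ (a • g) ≐ a • (f ⊠ g)
  ⊠-scalarʳ a f g n = trans (⊠-comm f (a • g) n) (trans (⊠-scalarˡ a g f n) (*-congˡ (⊠-comm g f n)))

  -- A record rather than a Π-type, so that f and g can be inferred from an equation.
  record _≈[_]_ (f : Series) (B : ℕ) (g : Series) : Set ℓ where
    constructor mk≈
    field get≈ : ∀ n → n ≤ B → f n ≈ g n
  open _≈[_]_ public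

  -- Series modulo x^(B+1).
  truncatedSemiring : ℕ → CommutativeSemiring c ℓ
  truncatedSemiring B = record
    { Carrier = Series ; _≈_ = _≈[ B ]_ ; _+_ = _⊞_ ; _*_ = _⊠_ ; 0# = 𝟘 ; 1# = 𝟙
    ; isCommutativeSemiring = record
      { isSemiring = record
        { isSemiringWithoutAnnihilatingZero = record
          { +-isCommutativeMonoid = record
            { isMonoid = record
              { isSemigroup = record
                { isMagma = record
                  { isEquivalence = record
                    { refl = mk≈ λ _ _ → refl
                    ; sym = λ e → mk≈ λ n n≤B → sym (get≈ e n n≤B)
                    ; trans = λ e e′ → mk≈ λ n n≤B → trans (get≈ e n n≤B) (get≈ e′ n n≤B) }
                  ; ∙-cong = λ e e′ → mk≈ λ n n≤B → +-cong (get≈ e n n≤B) (get≈ e′ n n≤B) }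
                ; assoc = λ _ _ _ → mk≈ λ _ _ → +-assoc _ _ _ }
              ; identity = (λ _ → mk≈ λ _ _ → +-identityˡ _) , (λ _ → mk≈ λ _ _ → +-identityʳ _) }
            ; comm = λ _ _ → mk≈ λ _ _ → +-comm _ _ }
          ; *-cong = λ e e′ → mk≈ λ n n≤B →
              ⊠-cong-≤ n (λ i i≤n → get≈ e i (ℕₚ.≤-trans i≤n n≤B)) (λ i i≤n → get≈ e′ i (ℕₚ.≤-trans i≤n n≤B))
          ; *-assoc = λ f g h → mk≈ λ n _ → ⊠-assoc f g h n
          ; *-identity = (λ f → mk≈ λ n _ → ⊠-identityˡ f n) , (λ f → mk≈ λ n _ → ⊠-identityʳ f n)
          ; distrib = (λ f g h → mk≈ λ n _ → ⊠-distribˡ f g h n) , (λ f g h → mk≈ λ n _ → ⊠-distribʳ g h f n) }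
        ; zero = (λ f → mk≈ λ n _ → ⊠-zeroˡ f n) , (λ f → mk≈ λ n _ → ⊠-zeroʳ f n) }
      ; *-comm = λ f g → mk≈ λ n _ → ⊠-comm f g n } }

  θ : Series → Series
  θ f n = ι n * f n

  shift-θ : ∀ f → shift (θ f) ≐ shift f ⊞ θ (shift f)
  shift-θ f n = trans (distribʳ _ 1# (ι n)) (+-congʳ (*-identityˡ _))

  θ-⊠ : ∀ f g → θ (f ⊠ g) ≐ θ f ⊠ g ⊞ f ⊠ θ g
  θ-⊠ f g zero = begin
    0# * (f 0 * g 0)                    ≈⟨ solve 2 (λ a b → con 0 :* (a :* b) := (con 0 :* a) :* b :+ a :* (con 0 :* b)) refl (f 0) (g 0) ⟩
    (0# * f 0) * g 0 + f 0 * (0# * g 0) ∎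
  θ-⊠ f g (suc n) = begin
    ι (suc n) * (f 0 * g (suc n) + A)
      ≈⟨ solve 4 (λ i a b x → (con 1 :+ i) :* (a :* b :+ x) := a :* ((con 1 :+ i) :* b) :+ (x :+ i :* x)) refl (ι n) (f 0) (g (suc n)) A ⟩
    f 0 * θ g (suc n) + (A + ι n * A)
      ≈⟨ +-congˡ (+-congˡ (θ-⊠ (shift f) g n)) ⟩
    f 0 * θ g (suc n) + (A + ((θ (shift f) ⊠ g) n + (shift f ⊠ θ g) n))
      ≈⟨ solve 6 (λ u v x a b c → x :+ (a :+ (b :+ c)) := ((con 0 :* u) :* v :+ (a :+ b)) :+ (x :+ c)) refl (f 0) (g (suc n)) _ A _ _ ⟩
    (θ f 0 * g (suc n) + (A + (θ (shift f) ⊠ g) n)) + (f 0 * θ g (suc n) + (shift f ⊠ θ g) n)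
      ≈⟨ +-congʳ (+-congˡ (sym (trans (⊠-cong (shift-θ f) (λ _ → refl) n) (⊠-distribʳ (shift f) (θ (shift f)) g n)))) ⟩
    (θ f ⊠ g) (suc n) + (f ⊠ θ g) (suc n) ∎
    where A = (shift f ⊠ g) n

  monomial : ℕ → Carrier → Series
  monomial zero v zero = v
  monomial zero v (suc n) = 0#
  monomial (suc c) v zero = 0#
  monomial (suc c) v (suc n) = monomial c v n

  monomial-coeff : ∀ c v n → monomial c v n ≈ when (n ≡ᵇ c) v
  monomial-coeff zero v zero = refl
  monomial-coeff zero v (suc n) = refl
  monomial-coeff (suc c) v zero = refl
  monomial-coeff (suc c) v (suc n) = monomial-coeff c v n

  monomial-⊠ : ∀ c v f n → (monomial c v ⊠ f) n ≈ when (c ≤ᵇ n) (v * f (n ∸ c))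
  monomial-⊠ zero v f zero = refl
  monomial-⊠ (suc c) v f zero = zeroˡ _
  monomial-⊠ zero v f (suc n) = trans (+-congˡ (⊠-zeroˡ f n)) (+-identityʳ _)
  monomial-⊠ (suc c) v f (suc n) = trans (+-cong (zeroˡ _) (monomial-⊠ c v f n))
    (trans (+-identityˡ _) (sym (when-≤ᵇ-suc c n _)))

  sumSeries : ℕ → (ℕ → Series) → Series
  sumSeries n F k = Σ< n (λ i → F i k)

  sumSeries-⊠ : ∀ n F g → sumSeries n F ⊠ g ≐ sumSeries n (λ i → F i ⊠ g)
  sumSeries-⊠ zero F g k = ⊠-zeroˡ g k
  sumSeries-⊠ (suc n) F g k =
    trans (⊠-distribʳ (F 0) (sumSeries n (F ∘ suc)) g k) (+-congˡ (sumSeries-⊠ n (F ∘ suc) g k))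

  -- dilate h m c = x^c · h(x^(m+1))
  dilate : Series → ℕ → ℕ → Series
  dilate h m zero zero = h 0
  dilate h m zero (suc p) = dilate (shift h) m m p
  dilate h m (suc c) zero = 0#
  dilate h m (suc c) (suc p) = dilate h m c p

  dilate-below : ∀ h m c p → p < c → dilate h m c p ≈ 0#
  dilate-below h m (suc c) zero _ = refl
  dilate-below h m (suc c) (suc p) (s≤s p<c) = dilate-below h m c p p<c

  dilate-offset : ∀ h m c p → dilate h m c (c ℕ.+ p) ≡ dilate h m 0 p
  dilate-offset h m zero p = ≡.refl
  dilate-offset h m (suc c) p = dilate-offset h m c p

  dilate-multiple : ∀ h m a → dilate h m 0 (a ℕ.* suc m) ≡ h a
  dilate-multiple h m zero = ≡.refl
  dilate-multiple h m (suc a) =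
    ≡.trans (dilate-offset (shift h) m m (a ℕ.* suc m)) (dilate-multiple (shift h) m a)

  dilate-nonmultiple : ∀ h m a r → r < m → dilate h m 0 (suc r ℕ.+ a ℕ.* suc m) ≈ 0#
  dilate-nonmultiple h m zero r r<m =
    dilate-below (shift h) m m (r ℕ.+ 0) (≡.subst (_< m) (≡.sym (ℕₚ.+-identityʳ r)) r<m)
  dilate-nonmultiple h m (suc a) r r<m = begin
    dilate (shift h) m m (r ℕ.+ suc a ℕ.* suc m)       ≡⟨ ≡.cong (dilate (shift h) m m) (index a) ⟩
    dilate (shift h) m m (m ℕ.+ suc r ℕ.+ a ℕ.* suc m) ≡⟨ ≡.cong (dilate (shift h) m m) (ℕₚ.+-assoc m (suc r) _) ⟩
    dilate (shift h) m m (m ℕ.+ (suc r ℕ.+ a ℕ.* suc m)) ≡⟨ dilate-offset (shift h) m m _ ⟩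
    dilate (shift h) m 0 (suc r ℕ.+ a ℕ.* suc m)       ≈⟨ dilate-nonmultiple (shift h) m a r r<m ⟩
    0#                                                 ∎
    where
    index : ∀ a → r ℕ.+ suc a ℕ.* suc m ≡ m ℕ.+ suc r ℕ.+ a ℕ.* suc m
    index a = rearrange r m (a ℕ.* suc m)
      where
      rearrange : ∀ r m x → r ℕ.+ suc (m ℕ.+ x) ≡ m ℕ.+ suc r ℕ.+ x
      rearrange = solve-∀

  dilate-⊠ : ∀ m c h F n B → n < B →
    (dilate h m c ⊠ F) n ≈ Σ< B (λ a → when (c ℕ.+ a ℕ.* suc m ≤ᵇ n) (h a * F (n ∸ (c ℕ.+ a ℕ.* suc m))))
  dilate-⊠ m zero h F zero (suc B) _ = sym (trans (+-congˡ (Σ<-zero B (λ _ _ → refl))) (+-identityʳ _))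
  dilate-⊠ m (suc c) h F zero (suc B) _ = trans (zeroˡ _) (sym (trans (+-congˡ (Σ<-zero B (λ _ _ → refl))) (+-identityʳ _)))
  dilate-⊠ m zero h F (suc n) (suc B) (s≤s n<B) =
    +-congˡ (trans (dilate-⊠ m m (shift h) F n B n<B) (Σ<-cong B (λ a _ → sym (when-≤ᵇ-suc (m ℕ.+ a ℕ.* suc m) n _))))
  dilate-⊠ m (suc c) h F (suc n) B n<B =
    trans (+-cong (zeroˡ _) (dilate-⊠ m c h F n B (ℕₚ.<-trans (ℕₚ.n<1+n n) n<B)))
      (trans (+-identityˡ _) (Σ<-cong B (λ a _ → sym (when-≤ᵇ-suc (c ℕ.+ a ℕ.* suc m) n _))))

record IntegerInverses {c ℓ} (R : CommutativeSemiring c ℓ) : Set (c ⊔ ℓ) where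
  open CommutativeSemiring R
  open SemiringSums R
  field
    inverse : ℕ → Carrier
    ι-inverse : ∀ n → ι (suc n) * inverse n ≈ 1#
    invFactorial : ℕ → Carrier
    invFactorial-0 : invFactorial 0 ≈ 1#
    ι-invFactorial : ∀ a → ι (suc a) * invFactorial (suc a) ≈ invFactorial a

module ExponentialFormula {c ℓ} (R : CommutativeSemiring c ℓ) (inverses : IntegerInverses R) where

  open CommutativeSemiring R
  open SemiringSums R
  open IntegerInverses inverses
  open import Data.Fin using (toℕ)
  import Data.Fin.Properties as Finₚ
  open PowerSeries R
  open import Relation.Binary.Reasoning.Setoid setoid
  open import Algebra.Solver.Ring.NaturalCoefficients.Default R
  open import Algebra.Definitions.RawSemiring rawSemiring using (_^_)
  open import Algebra.Properties.Semiring.Exp semiring using (^-homo-*)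
  open import Algebra.Properties.Semiring.Mult semiring using (×1-homo-*)

  ι-* : ∀ m n → ι (m ℕ.* n) ≈ ι m * ι n
  ι-* = ×1-homo-*

  expCoeff : Carrier → ℕ → Carrier
  expCoeff Y a = Y ^ a * invFactorial a

  -- exp(Y x^(i+1))
  expSeries : ℕ → Carrier → Series
  expSeries i Y = dilate (expCoeff Y) i 0

  expCoeff-0 : ∀ Y → expCoeff Y 0 ≈ 1#
  expCoeff-0 Y = trans (*-identityˡ _) invFactorial-0

  expSeries-0 : ∀ i Y → expSeries i Y 0 ≈ 1#
  expSeries-0 i = expCoeff-0

  θ-expSeries′ : ∀ i Y r a → r < suc i → let n = r ℕ.+ a ℕ.* suc i in
    θ (expSeries i Y) n ≈ (monomial (suc i) (ι (suc i) * Y) ⊠ expSeries i Y) n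
  θ-expSeries′ i Y zero zero _ = trans (zeroˡ _) (sym (monomial-⊠ (suc i) (ι (suc i) * Y) (expSeries i Y) 0))
  θ-expSeries′ i Y zero (suc a) _ = sym (begin
    (monomial M v ⊠ E) n                          ≈⟨ monomial-⊠ M v E n ⟩
    when (M ≤ᵇ n) (v * E (n ∸ M))                 ≡⟨ ≡.cong (λ b → when b (v * E (n ∸ M))) (≤ᵇ-true (ℕₚ.m≤m+n M (a ℕ.* M))) ⟩
    v * E (M ℕ.+ a ℕ.* M ∸ M)                     ≡⟨ ≡.cong (λ z → v * E z) (ℕₚ.m+n∸m≡n M (a ℕ.* M)) ⟩
    v * E (a ℕ.* M)                               ≡⟨ ≡.cong (v *_) (dilate-multiple (expCoeff Y) i a) ⟩
    (ι M * Y) * (Y ^ a * invFactorial a)          ≈⟨ *-congˡ (*-congˡ (sym (ι-invFactorial a))) ⟩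
    (ι M * Y) * (Y ^ a * (ι (suc a) * invFactorial (suc a)))
      ≈⟨ solve 5 (λ m y p j f → (m :* y) :* (p :* (j :* f)) := (j :* m) :* ((y :* p) :* f)) refl
                 (ι M) Y (Y ^ a) (ι (suc a)) (invFactorial (suc a)) ⟩
    (ι (suc a) * ι M) * expCoeff Y (suc a)        ≈⟨ *-congʳ (sym (ι-* (suc a) M)) ⟩
    ι n * expCoeff Y (suc a)                      ≡⟨ ≡.cong (ι n *_) (≡.sym (dilate-multiple (expCoeff Y) i (suc a))) ⟩
    θ E n                                         ∎)
    where
    M = suc i
    v = ι M * Y
    E = expSeries i Y
    n = suc a ℕ.* M
  θ-expSeries′ i Y (suc r) a (s≤s r<i) = begin
    ι n * E n                     ≈⟨ *-congˡ (dilate-nonmultiple (expCoeff Y) i a r r<i) ⟩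
    ι n * 0#                      ≈⟨ zeroʳ _ ⟩
    0#                            ≈⟨ sym (when-vanish (M ≤ᵇ n) vanish) ⟩
    when (M ≤ᵇ n) (v * E (n ∸ M)) ≈⟨ sym (monomial-⊠ M v E n) ⟩
    (monomial M v ⊠ E) n          ∎
    where
    M = suc i
    v = ι M * Y
    E = expSeries i Y
    n = suc r ℕ.+ a ℕ.* M
    vanish : (M ≤ᵇ n) ≡.≡ true → v * E (n ∸ M) ≈ 0#
    vanish M≤ᵇn = trans (*-congˡ (≡.subst (λ z → E z ≈ 0#) (≡.sym n∸M)
                    (dilate-nonmultiple (expCoeff Y) i (a ∸ 1) r r<i))) (zeroʳ v)
      where
      1*M≤n : 1 ℕ.* M ≤ n
      1*M≤n = ≡.subst (_≤ n) (≡.sym (ℕₚ.*-identityˡ M)) (≤ᵇ-true⁻ M≤ᵇn)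
      n∸M : n ∸ M ≡.≡ suc r ℕ.+ (a ∸ 1) ℕ.* M
      n∸M = ≡.trans (≡.cong (n ∸_) (≡.sym (ℕₚ.*-identityˡ M)))
              (r+a*m∸b*m≡r+[a∸b]*m (suc r) a 1 M (b*m≤r+a*m⇒b≤a (s≤s r<i) 1*M≤n))

  θ-expSeries : ∀ i Y → θ (expSeries i Y) ≐ expSeries i Y ⊠ monomial (suc i) (ι (suc i) * Y)
  θ-expSeries i Y n with n divMod suc i
  ... | result a r ≡.refl = trans (θ-expSeries′ i Y (toℕ r) a (Finₚ.toℕ<n r))
                                  (⊠-comm (monomial (suc i) (ι (suc i) * Y)) (expSeries i Y) (toℕ r ℕ.+ a ℕ.* suc i))

  -- 1 / (1 - U x^(m+1))
  geometric : ℕ → Carrier → Series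
  geometric m U = dilate (U ^_) m 0

  -- θ log (geometric m U), truncated after N terms
  logGeometric : ℕ → ℕ → Carrier → Series
  logGeometric N m U = sumSeries N (λ d → monomial (suc d ℕ.* suc m) (ι (suc m) * U ^ suc d))

  θ-geometric′ : ∀ N m U r a → r < suc m → r ℕ.+ a ℕ.* suc m ≤ N → let n = r ℕ.+ a ℕ.* suc m in
    θ (geometric m U) n ≈
    Σ< N (λ d → when (suc d ℕ.* suc m ≤ᵇ n) ((ι (suc m) * U ^ suc d) * geometric m U (n ∸ suc d ℕ.* suc m)))
  θ-geometric′ N m U zero a _ n≤N = sym (begin
    Σ< N (λ d → when (suc d ℕ.* M ≤ᵇ n) ((ι M * U ^ suc d) * geometric m U (n ∸ suc d ℕ.* M)))
      ≈⟨ Σ<-cong N (λ d _ → term d) ⟩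
    Σ< N (λ d → when (suc d ≤ᵇ a) (ι M * U ^ a)) ≈⟨ Σ<-count N a _ (ℕₚ.≤-trans (ℕₚ.m≤m*n a M) n≤N) ⟩
    ι a * (ι M * U ^ a)                          ≈⟨ sym (*-assoc _ _ _) ⟩
    (ι a * ι M) * U ^ a                          ≈⟨ *-congʳ (sym (ι-* a M)) ⟩
    ι n * U ^ a                                  ≡⟨ ≡.cong (ι n *_) (≡.sym (dilate-multiple (U ^_) m a)) ⟩
    θ (geometric m U) n                          ∎)
    where
    M = suc m
    n = a ℕ.* M
    term : ∀ d → when (suc d ℕ.* M ≤ᵇ n) ((ι M * U ^ suc d) * geometric m U (n ∸ suc d ℕ.* M))
                 ≈ when (suc d ≤ᵇ a) (ι M * U ^ a)
    term d with suc d ℕ.≤? a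
    ... | yes d<a rewrite ≤ᵇ-true (ℕₚ.*-monoˡ-≤ M d<a) | ≤ᵇ-true d<a = begin
      (ι M * U ^ suc d) * geometric m U (n ∸ suc d ℕ.* M)
        ≡⟨ ≡.cong (λ z → (ι M * U ^ suc d) * geometric m U z) (r+a*m∸b*m≡r+[a∸b]*m 0 a (suc d) M d<a) ⟩
      (ι M * U ^ suc d) * geometric m U ((a ∸ suc d) ℕ.* M)
        ≡⟨ ≡.cong ((ι M * U ^ suc d) *_) (dilate-multiple (U ^_) m (a ∸ suc d)) ⟩
      (ι M * U ^ suc d) * U ^ (a ∸ suc d) ≈⟨ *-assoc _ _ _ ⟩
      ι M * (U ^ suc d * U ^ (a ∸ suc d)) ≈⟨ *-congˡ (sym (^-homo-* U (suc d) (a ∸ suc d))) ⟩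
      ι M * U ^ (suc d ℕ.+ (a ∸ suc d))   ≡⟨ ≡.cong (λ z → ι M * U ^ z) (ℕₚ.m+[n∸m]≡n d<a) ⟩
      ι M * U ^ a                         ∎
    ... | no d≮a rewrite ≤ᵇ-false (ℕₚ.*-monoˡ-< M (ℕₚ.≰⇒> d≮a)) | ≤ᵇ-false (ℕₚ.≰⇒> d≮a) = refl
  θ-geometric′ N m U (suc r) a (s≤s r<m) _ = begin
    ι n * geometric m U n ≈⟨ *-congˡ (dilate-nonmultiple (U ^_) m a r r<m) ⟩
    ι n * 0#              ≈⟨ zeroʳ _ ⟩
    0#                    ≈⟨ sym (Σ<-zero N (λ d _ → when-vanish (suc d ℕ.* M ≤ᵇ n) (vanish d))) ⟩
    Σ< N (λ d → when (suc d ℕ.* M ≤ᵇ n) ((ι M * U ^ suc d) * geometric m U (n ∸ suc d ℕ.* M))) ∎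
    where
    M = suc m
    n = suc r ℕ.+ a ℕ.* M
    vanish : ∀ d → (suc d ℕ.* M ≤ᵇ n) ≡.≡ true → (ι M * U ^ suc d) * geometric m U (n ∸ suc d ℕ.* M) ≈ 0#
    vanish d d*M≤ᵇn = trans (*-congˡ (≡.subst (λ z → geometric m U z ≈ 0#) (≡.sym n∸d*M)
                        (dilate-nonmultiple (U ^_) m (a ∸ suc d) r r<m))) (zeroʳ _)
      where
      n∸d*M : n ∸ suc d ℕ.* M ≡.≡ suc r ℕ.+ (a ∸ suc d) ℕ.* M
      n∸d*M = r+a*m∸b*m≡r+[a∸b]*m (suc r) a (suc d) M (b*m≤r+a*m⇒b≤a (s≤s r<m) (≤ᵇ-true⁻ d*M≤ᵇn))

  ⊠-logGeometric : ∀ N m U G n → (G ⊠ logGeometric N m U) n ≈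
    Σ< N (λ d → when (suc d ℕ.* suc m ≤ᵇ n) ((ι (suc m) * U ^ suc d) * G (n ∸ suc d ℕ.* suc m)))
  ⊠-logGeometric N m U G n = begin
    (G ⊠ logGeometric N m U) n ≈⟨ ⊠-comm G _ n ⟩
    (logGeometric N m U ⊠ G) n ≈⟨ sumSeries-⊠ N _ G n ⟩
    Σ< N (λ d → (monomial (suc d ℕ.* suc m) (ι (suc m) * U ^ suc d) ⊠ G) n)
      ≈⟨ Σ<-cong N (λ d _ → monomial-⊠ (suc d ℕ.* suc m) (ι (suc m) * U ^ suc d) G n) ⟩
    Σ< N (λ d → when (suc d ℕ.* suc m ≤ᵇ n) ((ι (suc m) * U ^ suc d) * G (n ∸ suc d ℕ.* suc m))) ∎

  θ-geometric : ∀ N m U n → n ≤ N → θ (geometric m U) n ≈ (geometric m U ⊠ logGeometric N m U) n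
  θ-geometric N m U n n≤N with n divMod suc m
  ... | result a r ≡.refl = trans (θ-geometric′ N m U (toℕ r) a (Finₚ.toℕ<n r) n≤N)
                                  (sym (⊠-logGeometric N m U (geometric m U) (toℕ r ℕ.+ a ℕ.* suc m)))

  LogDeriv : ℕ → Series → Series → Set ℓ
  LogDeriv N F L = ∀ n → n ≤ N → θ F n ≈ (F ⊠ L) n

  logDeriv-𝟙 : ∀ N → LogDeriv N 𝟙 𝟘
  logDeriv-𝟙 N n _ = trans (θ-𝟙 n) (sym (⊠-zeroʳ 𝟙 n))
    where
    θ-𝟙 : ∀ n → θ 𝟙 n ≈ 0#
    θ-𝟙 zero = zeroˡ _
    θ-𝟙 (suc n) = zeroʳ _

  logDeriv-⊠ : ∀ N {F G L M} → LogDeriv N F L → LogDeriv N G M → LogDeriv N (F ⊠ G) (L ⊞ M)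
  logDeriv-⊠ N {F} {G} {L} {M} hF hG n n≤N = begin
    θ (F ⊠ G) n                   ≈⟨ θ-⊠ F G n ⟩
    (θ F ⊠ G) n + (F ⊠ θ G) n     ≈⟨ +-cong (⊠-cong-≤ n (λ i i≤n → hF i (ℕₚ.≤-trans i≤n n≤N)) (λ _ _ → refl))
                                            (⊠-cong-≤ n (λ _ _ → refl) (λ i i≤n → hG i (ℕₚ.≤-trans i≤n n≤N))) ⟩
    ((F ⊠ L) ⊠ G) n + (F ⊠ (G ⊠ M)) n
      ≈⟨ +-cong (trans (⊠-assoc F L G n) (trans (⊠-cong (λ _ → refl) (⊠-comm L G) n) (sym (⊠-assoc F G L n))))
                (sym (⊠-assoc F G M n)) ⟩
    ((F ⊠ G) ⊠ L) n + ((F ⊠ G) ⊠ M) n ≈⟨ sym (⊠-distribˡ (F ⊠ G) L M n) ⟩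
    ((F ⊠ G) ⊠ (L ⊞ M)) n           ∎

  logDeriv-congʳ : ∀ N {F L L′} → LogDeriv N F L → (∀ n → n ≤ N → L n ≈ L′ n) → LogDeriv N F L′
  logDeriv-congʳ N h e n n≤N = trans (h n n≤N) (⊠-cong-≤ n (λ _ _ → refl) (λ i i≤n → e i (ℕₚ.≤-trans i≤n n≤N)))

  ι-cancel : ∀ n {x y} → ι (suc n) * x ≈ ι (suc n) * y → x ≈ y
  ι-cancel n {x} {y} e = begin
    x                          ≈⟨ sym (*-identityˡ x) ⟩
    1# * x                     ≈⟨ *-congʳ (sym inv) ⟩
    (inverse n * ι (suc n)) * x ≈⟨ *-assoc _ _ _ ⟩
    inverse n * (ι (suc n) * x) ≈⟨ *-congˡ e ⟩
    inverse n * (ι (suc n) * y) ≈⟨ sym (*-assoc _ _ _) ⟩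
    (inverse n * ι (suc n)) * y ≈⟨ *-congʳ inv ⟩
    1# * y                     ≈⟨ *-identityˡ y ⟩
    y                          ∎
    where inv = trans (*-comm _ _) (ι-inverse n)

  -- Compare x^(n+1)-coefficients and cancel n + 1.
  logDeriv-unique : ∀ N {F G L} → L 0 ≈ 0# → F 0 ≈ G 0 → LogDeriv N F L → LogDeriv N G L →
                    ∀ n → n ≤ N → F n ≈ G n
  logDeriv-unique N {F} {G} {L} L0≈0 F0≈G0 hF hG n n≤N = below n n≤N n ℕₚ.≤-refl
    where
    L0*≈0 : ∀ x → L 0 * x ≈ 0#
    L0*≈0 x = trans (*-congʳ L0≈0) (zeroˡ x)
    below : ∀ n → n ≤ N → ∀ i → i ≤ n → F i ≈ G i
    below zero _ zero _ = F0≈G0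
    below (suc n) n<N i i≤1+n with i ℕ.≤? n
    ... | yes i≤n = below n (ℕₚ.<⇒≤ n<N) i i≤n
    ... | no i≰n rewrite ℕₚ.≤-antisym i≤1+n (ℕₚ.≰⇒> i≰n) = ι-cancel n (begin
      ι (suc n) * F (suc n)       ≈⟨ hF (suc n) n<N ⟩
      (F ⊠ L) (suc n)             ≈⟨ ⊠-comm F L (suc n) ⟩
      L 0 * F (suc n) + (shift L ⊠ F) n
        ≈⟨ +-cong (trans (L0*≈0 _) (sym (L0*≈0 _))) (⊠-cong-≤ n (λ _ _ → refl) (below n (ℕₚ.<⇒≤ n<N))) ⟩
      L 0 * G (suc n) + (shift L ⊠ G) n ≈⟨ ⊠-comm L G (suc n) ⟩
      (G ⊠ L) (suc n)             ≈⟨ sym (hG (suc n) n<N) ⟩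
      ι (suc n) * G (suc n)       ∎)

  -- expProduct ys j K = ∏_{i = j+1}^{j+K} exp(ys i · x^i)
  expProduct : (ℕ → Carrier) → ℕ → ℕ → Series
  expProduct ys j zero = 𝟙
  expProduct ys j (suc K) = expSeries j (ys (suc j)) ⊠ expProduct ys (suc j) K

  expProductLog : (ℕ → Carrier) → ℕ → ℕ → Series
  expProductLog ys j zero = 𝟘
  expProductLog ys j (suc K) = monomial (suc j) (ι (suc j) * ys (suc j)) ⊞ expProductLog ys (suc j) K

  θ-expProduct : ∀ N ys j K → LogDeriv N (expProduct ys j K) (expProductLog ys j K)
  θ-expProduct N ys j zero = logDeriv-𝟙 N
  θ-expProduct N ys j (suc K) =
    logDeriv-⊠ N (λ n _ → θ-expSeries j (ys (suc j)) n) (θ-expProduct N ys (suc j) K)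

  expProduct-0 : ∀ ys j K → expProduct ys j K 0 ≈ 1#
  expProduct-0 ys j zero = refl
  expProduct-0 ys j (suc K) = trans (*-cong (expSeries-0 j (ys (suc j))) (expProduct-0 ys (suc j) K)) (*-identityˡ _)

  expProductLog-below : ∀ ys j K n → n ≤ j → expProductLog ys j K n ≈ 0#
  expProductLog-below ys j zero n _ = refl
  expProductLog-below ys j (suc K) n n≤j = begin
    monomial (suc j) v n + expProductLog ys (suc j) K n
      ≈⟨ +-cong (monomial-coeff (suc j) v n) (expProductLog-below ys (suc j) K n (ℕₚ.m≤n⇒m≤1+n n≤j)) ⟩
    when (n ≡ᵇ suc j) v + 0#
      ≡⟨ ≡.cong (λ b → when b v + 0#) (≡ᵇ-false (ℕₚ.<⇒≢ (s≤s n≤j))) ⟩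
    0# + 0#                  ≈⟨ +-identityʳ 0# ⟩
    0#                       ∎
    where v = ι (suc j) * ys (suc j)

  expProductLog-coeff : ∀ ys j K n → j < n → n ≤ j ℕ.+ K → expProductLog ys j K n ≈ ι n * ys n
  expProductLog-coeff ys j zero n j<n n≤j+0 =
    contradiction (≡.subst (n ≤_) (ℕₚ.+-identityʳ j) n≤j+0) (ℕₚ.<⇒≱ j<n)
  expProductLog-coeff ys j (suc K) n j<n n≤j+1+K with n ℕ.≟ suc j
  ... | yes ≡.refl = begin
    monomial (suc j) v (suc j) + expProductLog ys (suc j) K (suc j)
      ≈⟨ +-cong (monomial-coeff (suc j) v (suc j)) (expProductLog-below ys (suc j) K (suc j) ℕₚ.≤-refl) ⟩
    when (suc j ≡ᵇ suc j) (ι (suc j) * ys (suc j)) + 0#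
      ≡⟨ ≡.cong (λ b → when b (ι (suc j) * ys (suc j)) + 0#) (≡ᵇ-true {suc j} ≡.refl) ⟩
    ι (suc j) * ys (suc j) + 0# ≈⟨ +-identityʳ _ ⟩
    ι (suc j) * ys (suc j)      ∎
    where v = ι (suc j) * ys (suc j)
  ... | no n≢1+j = begin
    monomial (suc j) v n + expProductLog ys (suc j) K n
      ≈⟨ +-cong (monomial-coeff (suc j) v n) (expProductLog-coeff ys (suc j) K n
           (ℕₚ.≤∧≢⇒< j<n (n≢1+j ∘ ≡.sym)) (≡.subst (n ≤_) (ℕₚ.+-suc j K) n≤j+1+K)) ⟩
    when (n ≡ᵇ suc j) v + ι n * ys n ≡⟨ ≡.cong (λ b → when b v + ι n * ys n) (≡ᵇ-false n≢1+j) ⟩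
    0# + ι n * ys n                  ≈⟨ +-identityˡ _ ⟩
    ι n * ys n                       ∎
    where v = ι (suc j) * ys (suc j)

  geometricProduct : List (ℕ × Carrier) → Series
  geometricProduct [] = 𝟙
  geometricProduct ((m , U) ∷ rs) = geometric m U ⊠ geometricProduct rs

  geometricProductLog : ℕ → List (ℕ × Carrier) → Series
  geometricProductLog N [] = 𝟘
  geometricProductLog N ((m , U) ∷ rs) = logGeometric N m U ⊞ geometricProductLog N rs

  θ-geometricProduct : ∀ N rs → LogDeriv N (geometricProduct rs) (geometricProductLog N rs)
  θ-geometricProduct N [] = logDeriv-𝟙 N
  θ-geometricProduct N ((m , U) ∷ rs) = logDeriv-⊠ N (θ-geometric N m U) (θ-geometricProduct N rs)

  geometricProduct-0 : ∀ rs → geometricProduct rs 0 ≈ 1#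
  geometricProduct-0 [] = refl
  geometricProduct-0 ((m , U) ∷ rs) = trans (*-congˡ (geometricProduct-0 rs)) (*-identityˡ _)

  -- The x^i-coefficient of log (geometricProduct rs) = Σ_{(m , U)} Σ_{(d+1)(m+1) = i} U^(d+1) / (d+1).
  logCoeff : ℕ → List (ℕ × Carrier) → ℕ → Carrier
  logCoeff N [] i = 0#
  logCoeff N ((m , U) ∷ rs) i =
    Σ< N (λ d → when (i ≡ᵇ suc d ℕ.* suc m) (U ^ suc d * inverse d)) + logCoeff N rs i

  ι-logTerm : ∀ m U d n → ι n * when (n ≡ᵇ suc d ℕ.* suc m) (U ^ suc d * inverse d)
                          ≈ when (n ≡ᵇ suc d ℕ.* suc m) (ι (suc m) * U ^ suc d)
  ι-logTerm m U d n with n ℕ.≟ suc d ℕ.* suc m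
  ... | no n≢ rewrite ≡ᵇ-false n≢ = zeroʳ _
  ... | yes ≡.refl rewrite ≡ᵇ-true (≡.refl {x = suc d ℕ.* suc m}) = begin
    ι (suc d ℕ.* suc m) * (U ^ suc d * inverse d)   ≈⟨ *-congʳ (ι-* (suc d) (suc m)) ⟩
    (ι (suc d) * ι (suc m)) * (U ^ suc d * inverse d)
      ≈⟨ solve 4 (λ a b p q → (a :* b) :* (p :* q) := (b :* p) :* (a :* q)) refl
                 (ι (suc d)) (ι (suc m)) (U ^ suc d) (inverse d) ⟩
    (ι (suc m) * U ^ suc d) * (ι (suc d) * inverse d) ≈⟨ *-congˡ (ι-inverse d) ⟩
    (ι (suc m) * U ^ suc d) * 1#                      ≈⟨ *-identityʳ _ ⟩
    ι (suc m) * U ^ suc d                             ∎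

  geometricProductLog-coeff : ∀ N rs n → geometricProductLog N rs n ≈ ι n * logCoeff N rs n
  geometricProductLog-coeff N [] n = sym (zeroʳ _)
  geometricProductLog-coeff N ((m , U) ∷ rs) n = sym (begin
    ι n * (Σ< N (λ d → when (n ≡ᵇ suc d ℕ.* suc m) (U ^ suc d * inverse d)) + logCoeff N rs n)
      ≈⟨ distribˡ _ _ _ ⟩
    ι n * Σ< N (λ d → when (n ≡ᵇ suc d ℕ.* suc m) (U ^ suc d * inverse d)) + ι n * logCoeff N rs n
      ≈⟨ +-cong (Σ<-*ˡ N (ι n) _) (sym (geometricProductLog-coeff N rs n)) ⟩
    Σ< N (λ d → ι n * when (n ≡ᵇ suc d ℕ.* suc m) (U ^ suc d * inverse d)) + geometricProductLog N rs n
      ≈⟨ +-congʳ (Σ<-cong N (λ d _ → trans (ι-logTerm m U d n) (sym (monomial-coeff (suc d ℕ.* suc m) _ n)))) ⟩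
    logGeometric N m U n + geometricProductLog N rs n ∎)

  geometricProduct≈expProduct : ∀ N rs ys → (∀ i → 1 ≤ i → i ≤ N → ys i ≈ logCoeff N rs i) →
                                ∀ n → n ≤ N → geometricProduct rs n ≈ expProduct ys 0 N n
  geometricProduct≈expProduct N rs ys ys≈ =
    logDeriv-unique N L0≈0 (trans (geometricProduct-0 rs) (sym (expProduct-0 ys 0 N)))
      (θ-geometricProduct N rs) (logDeriv-congʳ N (θ-expProduct N ys 0 N) (λ n n≤N → sym (L≈ n n≤N)))
    where
    L0≈0 : geometricProductLog N rs 0 ≈ 0#
    L0≈0 = trans (geometricProductLog-coeff N rs 0) (zeroˡ _)
    L≈ : ∀ n → n ≤ N → geometricProductLog N rs n ≈ expProductLog ys 0 N n
    L≈ zero _ = trans L0≈0 (sym (expProductLog-below ys 0 N 0 z≤n))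
    L≈ (suc n) n<N = begin
      geometricProductLog N rs (suc n) ≈⟨ geometricProductLog-coeff N rs (suc n) ⟩
      ι (suc n) * logCoeff N rs (suc n) ≈⟨ *-congˡ (sym (ys≈ (suc n) (s≤s z≤n) n<N)) ⟩
      ι (suc n) * ys (suc n)           ≈⟨ sym (expProductLog-coeff ys 0 N (suc n) (s≤s z≤n) n<N) ⟩
      expProductLog ys 0 N (suc n)     ∎

module RationalFacts where

  open import Data.Integer as ℤ using (+_)
  import Data.Integer.Properties as ℤₚ
  open import Data.Rational.Unnormalised as ℚᵘ using (mkℚᵘ; *≡*)
  import Data.Rational.Unnormalised.Properties as ℚᵘₚ

  ℚ-semiring : CommutativeSemiring 0ℓ 0ℓ
  ℚ-semiring = CommutativeRing.commutativeSemiring ℚₚ.+-*-commutativeRing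

  open SemiringSums ℚ-semiring using (ι)

  1/suc : ℕ → ℚ
  1/suc d = (+ 1) ℚ./ suc d

  toℚᵘ-/ : ∀ i d → toℚᵘ (i ℚ./ suc d) ℚᵘ.≃ mkℚᵘ i d
  toℚᵘ-/ i d = ℚₚ.toℚᵘ-fromℚᵘ (mkℚᵘ i d)

  fromℕ-suc : ∀ n → fromℕ (suc n) ≡ 1ℚ ℚ.+ fromℕ n
  fromℕ-suc n = ℚₚ.toℚᵘ-injective (ℚᵘₚ.≃-trans (toℚᵘ-/ (+ suc n) 0) (ℚᵘₚ.≃-sym
    (ℚᵘₚ.≃-trans (ℚₚ.toℚᵘ-homo-+ 1ℚ (fromℕ n)) (ℚᵘₚ.≃-trans (ℚᵘₚ.+-cong (toℚᵘ-/ (+ 1) 0) (toℚᵘ-/ (+ n) 0)) (*≡* eq)))))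
    where
    eq : (+ 1 ℤ.* + 1 ℤ.+ + n ℤ.* + 1) ℤ.* + 1 ≡ + suc n ℤ.* + 1
    eq = ≡.trans (ℤₚ.*-identityʳ _) (≡.trans (≡.cong₂ ℤ._+_ (ℤₚ.*-identityʳ (+ 1)) (ℤₚ.*-identityʳ (+ n))) (≡.sym (ℤₚ.*-identityʳ _)))

  fromℕ*1/suc : ∀ d → fromℕ (suc d) ℚ.* 1/suc d ≡ 1ℚ
  fromℕ*1/suc d = ℚₚ.toℚᵘ-injective (ℚᵘₚ.≃-trans (ℚₚ.toℚᵘ-homo-* (fromℕ (suc d)) (1/suc d))
    (ℚᵘₚ.≃-trans (ℚᵘₚ.*-cong (toℚᵘ-/ (+ suc d) 0) (toℚᵘ-/ (+ 1) d)) (*≡* eq)))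
    where
    eq : (+ suc d ℤ.* + 1) ℤ.* + 1 ≡ + 1 ℤ.* (+ (suc (0 ℕ.+ d ℕ.+ 0 ℕ.* suc d)))
    eq = ≡.trans (ℤₚ.*-identityʳ _) (≡.trans (ℤₚ.*-identityʳ _)
           (≡.trans (≡.cong (λ z → + suc z) (≡.sym (ℕₚ.+-identityʳ d))) (≡.sym (ℤₚ.*-identityˡ _))))

  1/suc-* : ∀ a b → 1/suc (b ℕ.+ a ℕ.* suc b) ≡ 1/suc a ℚ.* 1/suc b
  1/suc-* a b = ℚₚ.toℚᵘ-injective (ℚᵘₚ.≃-trans (toℚᵘ-/ (+ 1) (b ℕ.+ a ℕ.* suc b)) (ℚᵘₚ.≃-sym
    (ℚᵘₚ.≃-trans (ℚₚ.toℚᵘ-homo-* (1/suc a) (1/suc b)) (ℚᵘₚ.≃-trans (ℚᵘₚ.*-cong (toℚᵘ-/ (+ 1) a) (toℚᵘ-/ (+ 1) b))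
      (*≡* (≡.cong (ℤ._* + suc (b ℕ.+ a ℕ.* suc b)) (ℤₚ.*-identityˡ (+ 1))))))))

  invFact≡1/suc : ∀ n → invFact n ≡ 1/suc (ℕ.pred (n !))
  invFact≡1/suc n = /-cong {{ℕₚ._!≢0 n}} (≡.sym (ℕₚ.suc-pred (n !) {{ℕₚ._!≢0 n}}))
    where
    /-cong : ∀ {m m′} .{{_ : ℕ.NonZero m}} .{{_ : ℕ.NonZero m′}} → m ≡ m′ → (+ 1) ℚ./ m ≡ (+ 1) ℚ./ m′
    /-cong ≡.refl = ≡.refl

  fromℕ-! : ∀ n → fromℕ (n !) ≡ fromℕ (suc (ℕ.pred (n !)))
  fromℕ-! n = ≡.cong fromℕ (≡.sym (ℕₚ.suc-pred (n !) {{ℕₚ._!≢0 n}}))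

  invFact*fromℕ! : ∀ n → invFact n ℚ.* fromℕ (n !) ≡ 1ℚ
  invFact*fromℕ! n = ≡.trans (ℚₚ.*-comm (invFact n) (fromℕ (n !)))
    (≡.trans (≡.cong₂ ℚ._*_ (fromℕ-! n) (invFact≡1/suc n)) (fromℕ*1/suc (ℕ.pred (n !))))

  fromℕ*invFact-suc : ∀ a → fromℕ (suc a) ℚ.* invFact (suc a) ≡ invFact a
  fromℕ*invFact-suc a = begin
    fromℕ (suc a) ℚ.* invFact (suc a)                         ≡⟨ ≡.cong (fromℕ (suc a) ℚ.*_) (≡.trans (invFact≡1/suc (suc a)) (≡.cong 1/suc (ℕ!-suc))) ⟩
    fromℕ (suc a) ℚ.* 1/suc (p ℕ.+ a ℕ.* suc p)               ≡⟨ ≡.cong (fromℕ (suc a) ℚ.*_) (1/suc-* a p) ⟩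
    fromℕ (suc a) ℚ.* (1/suc a ℚ.* 1/suc p)                   ≡⟨ ≡.sym (ℚₚ.*-assoc (fromℕ (suc a)) _ _) ⟩
    (fromℕ (suc a) ℚ.* 1/suc a) ℚ.* 1/suc p                   ≡⟨ ≡.cong₂ ℚ._*_ (fromℕ*1/suc a) (≡.sym (invFact≡1/suc a)) ⟩
    1ℚ ℚ.* invFact a                                          ≡⟨ ℚₚ.*-identityˡ _ ⟩
    invFact a                                                 ∎
    where
    open ≡.≡-Reasoning
    p = ℕ.pred (a !)
    ℕ!-suc : ℕ.pred (suc a !) ≡ p ℕ.+ a ℕ.* suc p
    ℕ!-suc = ≡.cong ℕ.pred (≡.cong (suc a ℕ.*_) (≡.sym (ℕₚ.suc-pred (a !) {{ℕₚ._!≢0 a}})))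

  fromℕ-+ : ∀ m n → fromℕ (m ℕ.+ n) ≡ fromℕ m ℚ.+ fromℕ n
  fromℕ-+ zero n = ≡.sym (ℚₚ.+-identityˡ (fromℕ n))
  fromℕ-+ (suc m) n = ≡.trans (fromℕ-suc (m ℕ.+ n)) (≡.trans (≡.cong (1ℚ ℚ.+_) (fromℕ-+ m n))
    (≡.trans (≡.sym (ℚₚ.+-assoc 1ℚ (fromℕ m) (fromℕ n))) (≡.cong (ℚ._+ fromℕ n) (≡.sym (fromℕ-suc m)))))

module RationalSeries where

  open RationalFacts
  module ℚΣ = SemiringSums ℚ-semiring
  module ℚS = PowerSeries ℚ-semiring

  -- ℚ[t] modulo t^(K+1); its elements are the series PS of the statement.
  𝔸 : ℕ → CommutativeSemiring 0ℓ 0ℓ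
  𝔸 K = ℚS.truncatedSemiring K

  const : ℚ → PS
  const = ℚS.monomial 0

  ⊠-const : ∀ c f n → (f ℚS.⊠ const c) n ≡ c ℚ.* f n
  ⊠-const c f n = ≡.trans (ℚS.⊠-comm f (const c) n) (ℚS.monomial-⊠ 0 c f n)

  ι-𝔸 : ∀ K n q → SemiringSums.ι (𝔸 K) n q ≡ const (fromℕ n) q
  ι-𝔸 K zero zero = ≡.refl
  ι-𝔸 K zero (suc q) = ≡.refl
  ι-𝔸 K (suc n) zero = ≡.trans (≡.cong (1ℚ ℚ.+_) (ι-𝔸 K n 0)) (≡.sym (fromℕ-suc n))
  ι-𝔸 K (suc n) (suc q) = ≡.trans (≡.cong (0ℚ ℚ.+_) (ι-𝔸 K n (suc q))) (ℚₚ.+-identityˡ _)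

  𝔸-inverses : ∀ K → IntegerInverses (𝔸 K)
  𝔸-inverses K = record
    { inverse = const ∘ 1/suc
    ; ι-inverse = ι-inverse
    ; invFactorial = const ∘ invFact
    ; invFactorial-0 = invFactorial-0
    ; ι-invFactorial = ι-invFactorial
    }
    where
    open CommutativeSemiring (𝔸 K) using (_≈_; _*_; 1#) renaming (trans to ≈-trans)
    open SemiringSums (𝔸 K) using (ι)

    ι-const : ∀ n c → ι n * const c ≈ const (fromℕ n ℚ.* c)
    ι-const n c = ℚS.mk≈ λ q _ → ≡.trans (⊠-const c (ι n) q) (≡.trans (≡.cong (c ℚ.*_) (ι-𝔸 K n q)) (value q))
      where
      value : ∀ q → c ℚ.* const (fromℕ n) q ≡ const (fromℕ n ℚ.* c) q
      value zero = ℚₚ.*-comm c (fromℕ n)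
      value (suc q) = ℚₚ.*-zeroʳ c

    ι-inverse : ∀ d → ι (suc d) * const (1/suc d) ≈ 1#
    ι-inverse d = ≈-trans (ι-const (suc d) (1/suc d)) (ℚS.mk≈ λ { zero _ → fromℕ*1/suc d ; (suc q) _ → ≡.refl })

    invFactorial-0 : const (invFact 0) ≈ 1#
    invFactorial-0 = ℚS.mk≈ λ { zero _ → ≡.refl ; (suc q) _ → ≡.refl }

    ι-invFactorial : ∀ a → ι (suc a) * const (invFact (suc a)) ≈ const (invFact a)
    ι-invFactorial a = ≈-trans (ι-const (suc a) (invFact (suc a))) (ℚS.mk≈ λ { zero _ → fromℕ*invFact-suc a ; (suc q) _ → ≡.refl })

  module 𝔸Exp (K : ℕ) = ExponentialFormula (𝔸 K) (𝔸-inverses K)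

  ⊗≡⊠ : ∀ f g m → (f ⊗ g) m ≡ (f ℚS.⊠ g) m
  ⊗≡⊠ f g m = ≡.trans (ℚΣ.listSum-applyUpTo (suc m) (λ i → f i ℚ.* g (m ℕ.∸ i)) (λ i → i)) (Σ<-convolution m f g)
    where
    Σ<-convolution : ∀ m (f g : PS) → ℚΣ.Σ< (suc m) (λ i → f i ℚ.* g (m ℕ.∸ i)) ≡ (f ℚS.⊠ g) m
    Σ<-convolution zero f g = ℚₚ.+-identityʳ _
    Σ<-convolution (suc m) f g = ≡.cong (f 0 ℚ.* g (suc m) ℚ.+_) (Σ<-convolution m (f ∘ suc) g)

  onePS≡𝟙 : ∀ m → onePS m ≡ ℚS.𝟙 m
  onePS≡𝟙 zero = ≡.refl
  onePS≡𝟙 (suc m) = ≡.refl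

  tPS≡monomial : ∀ m → tPS m ≡ ℚS.monomial 1 1ℚ m
  tPS≡monomial zero = ≡.refl
  tPS≡monomial (suc zero) = ≡.refl
  tPS≡monomial (suc (suc m)) = ≡.refl

  fromℕ-Σ< : ∀ n f → fromℕ (ℕΣ.Σ< n f) ≡ ℚΣ.Σ< n (fromℕ ∘ f)
  fromℕ-Σ< zero f = ≡.refl
  fromℕ-Σ< (suc n) f = ≡.trans (fromℕ-+ (f 0) _) (≡.cong (fromℕ (f 0) ℚ.+_) (fromℕ-Σ< n (f ∘ suc)))

  fromℕ-when : ∀ b x → fromℕ (ℕΣ.when b x) ≡ ℚΣ.when b (fromℕ x)
  fromℕ-when true x = ≡.refl
  fromℕ-when false x = ≡.refl

  sumPS-at : ∀ (G : ℕ → PS) n h q → sumPS (map G (applyUpTo h n)) q ≡ ℚΣ.Σ< n (λ e → G (h e) q)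
  sumPS-at G zero h q = ≡.refl
  sumPS-at G (suc n) h q = ≡.cong (G (h 0) q ℚ.+_) (sumPS-at G n (h ∘ suc) q)

  if-at : ∀ b (X : PS) q → (if b then X else zeroPS) q ≡ ℚΣ.when b (X q)
  if-at true X q = ≡.refl
  if-at false X q = ≡.refl

i*sum≤wsum : ∀ i α → i ℕ.* sumℕ α ≤ wsum i α
i*sum≤wsum i [] = ℕₚ.≤-reflexive (ℕₚ.*-zeroʳ i)
i*sum≤wsum i (a ∷ α) = ≡.subst (_≤ i ℕ.* a ℕ.+ wsum (suc i) α) (≡.sym (ℕₚ.*-distribˡ-+ i a (sumℕ α)))
  (ℕₚ.+-monoʳ-≤ (i ℕ.* a) (ℕₚ.≤-trans (ℕₚ.*-monoˡ-≤ (sumℕ α) (ℕₚ.n≤1+n i)) (i*sum≤wsum (suc i) α)))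

sum≡0⇒wsum≡0 : ∀ i α → sumℕ α ≡ 0 → wsum i α ≡ 0
sum≡0⇒wsum≡0 i [] _ = ≡.refl
sum≡0⇒wsum≡0 i (a ∷ α) e = ≡.cong₂ ℕ._+_ (≡.trans (≡.cong (i ℕ.*_) (ℕₚ.m+n≡0⇒m≡0 a e)) (ℕₚ.*-zeroʳ i))
  (sum≡0⇒wsum≡0 (suc i) α (ℕₚ.m+n≡0⇒n≡0 a e))

module BellExpansion (K : ℕ) where

  open RationalFacts
  open RationalSeries
  open CommutativeSemiring (𝔸 K) hiding (zero)
  open SemiringSums (𝔸 K)
  open 𝔸Exp K using (expCoeff; expCoeff-0; expProduct)
  open PowerSeries (𝔸 K) using (dilate-⊠)
  open import Relation.Binary.Reasoning.Setoid setoid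
  open import Algebra.Definitions.RawSemiring (CommutativeSemiring.rawSemiring (𝔸 K)) using (_^_)

  pow≡^ : ∀ f a q → pow f a q ≡ (f ^ a) q
  pow≡^ f zero q = onePS≡𝟙 q
  pow≡^ f (suc a) q = ≡.trans (⊗≡⊠ f (pow f a) q) (ℚS.⊠-cong (λ _ → ≡.refl) (pow≡^ f a) q)

  tupleTerm : (ℕ → PS) → ℕ → List ℕ → PS
  tupleTerm Y i [] = 1#
  tupleTerm Y i (a ∷ α) = expCoeff (Y i) a * tupleTerm Y (suc i) α

  tupleSum : (ℕ → PS) → (List ℕ → Bool) → ℕ → ℕ → ℕ → PS
  tupleSum Y P i N b = listSum (map (λ α → when (P α) (tupleTerm Y i α)) (tuples N b))

  tupleSum-cong : ∀ Y {P P′} i N b → (∀ α → P α ≡ P′ α) → tupleSum Y P i N b ≈ tupleSum Y P′ i N b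
  tupleSum-cong Y i N b e = listSum-cong (tuples N b) (λ α → reflexive (≡.cong (λ z → when z (tupleTerm Y i α)) (e α)))

  tupleSum-∧ : ∀ Y c P i N b → tupleSum Y (λ α → c ∧ P α) i N b ≈ when c (tupleSum Y P i N b)
  tupleSum-∧ Y true P i N b = refl
  tupleSum-∧ Y false P i N b = listSum-zero _ (tuples N b) (λ _ → refl)

  tupleSum-suc : ∀ Y P i N b → tupleSum Y P i (suc N) b ≈
    Σ< (suc b) (λ a → expCoeff (Y i) a * tupleSum Y (P ∘ (a ∷_)) (suc i) N b)
  tupleSum-suc Y P i N b = begin
    listSum (map G (concatMap (λ a → map (a ∷_) (tuples N b)) (upTo (suc b))))
      ≈⟨ listSum-concatMap G (λ a → map (a ∷_) (tuples N b)) (upTo (suc b)) ⟩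
    listSum (map (λ a → listSum (map G (map (a ∷_) (tuples N b)))) (upTo (suc b)))
      ≈⟨ listSum-applyUpTo (suc b) (λ a → listSum (map G (map (a ∷_) (tuples N b)))) (λ a → a) ⟩
    Σ< (suc b) (λ a → listSum (map G (map (a ∷_) (tuples N b))))
      ≈⟨ Σ<-cong (suc b) (λ a _ → head a) ⟩
    Σ< (suc b) (λ a → expCoeff (Y i) a * tupleSum Y (P ∘ (a ∷_)) (suc i) N b) ∎
    where
    G = λ α → when (P α) (tupleTerm Y i α)
    head : ∀ a → listSum (map G (map (a ∷_) (tuples N b))) ≈ expCoeff (Y i) a * tupleSum Y (P ∘ (a ∷_)) (suc i) N b
    head a = begin
      listSum (map G (map (a ∷_) (tuples N b))) ≡⟨ ≡.cong listSum (≡.sym (Listₚ.map-∘ (tuples N b))) ⟩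
      listSum (map (G ∘ (a ∷_)) (tuples N b))
        ≈⟨ listSum-cong (tuples N b) (λ α → sym (*-when (P (a ∷ α)) (expCoeff (Y i) a) _)) ⟩
      listSum (map (λ α → expCoeff (Y i) a * when (P (a ∷ α)) (tupleTerm Y (suc i) α)) (tuples N b))
        ≈⟨ sym (listSum-*ˡ (expCoeff (Y i) a) _ (tuples N b)) ⟩
      expCoeff (Y i) a * tupleSum Y (P ∘ (a ∷_)) (suc i) N b ∎

  hasWeight : ℕ → ℕ → List ℕ → Bool
  hasWeight i n α = wsum i α ≡ᵇ n

  hasSizeWeight : ℕ → ℕ → ℕ → List ℕ → Bool
  hasSizeWeight i n j α = (sumℕ α ≡ᵇ j) ∧ hasWeight i n α

  weightSum : (ℕ → PS) → ℕ → ℕ → ℕ → ℕ → PS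
  weightSum Y i N b n = tupleSum Y (hasWeight i n) i N b

  bellSum : (ℕ → PS) → ℕ → ℕ → ℕ → ℕ → ℕ → PS
  bellSum Y i N b n j = tupleSum Y (hasSizeWeight i n j) i N b

  hasWeight-∷ : ∀ i n a α → hasWeight i n (a ∷ α) ≡ ((i ℕ.* a ≤ᵇ n) ∧ hasWeight (suc i) (n ∸ i ℕ.* a) α)
  hasWeight-∷ i n a α = +-≡ᵇ (i ℕ.* a) (wsum (suc i) α) n

  hasSizeWeight-∷ : ∀ i n j a α → hasSizeWeight i n j (a ∷ α) ≡
    (((a ≤ᵇ j) ∧ (i ℕ.* a ≤ᵇ n)) ∧ hasSizeWeight (suc i) (n ∸ i ℕ.* a) (j ∸ a) α)
  hasSizeWeight-∷ i n j a α = ≡.trans (≡.cong₂ _∧_ (+-≡ᵇ a (sumℕ α) j) (hasWeight-∷ i n a α))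
    (∧-interchange (a ≤ᵇ j) _ (i ℕ.* a ≤ᵇ n) _)

  weightSum-suc : ∀ Y i N b n → weightSum Y i (suc N) b n ≈
    Σ< (suc b) (λ a → expCoeff (Y i) a * when (i ℕ.* a ≤ᵇ n) (weightSum Y (suc i) N b (n ∸ i ℕ.* a)))
  weightSum-suc Y i N b n = trans (tupleSum-suc Y (hasWeight i n) i N b) (Σ<-cong (suc b) λ a _ → *-congˡ {expCoeff (Y i) a}
    (trans (tupleSum-cong Y (suc i) N b (hasWeight-∷ i n a))
           (tupleSum-∧ Y (i ℕ.* a ≤ᵇ n) (hasWeight (suc i) (n ∸ i ℕ.* a)) (suc i) N b)))

  bellSum-suc : ∀ Y i N b n j → bellSum Y i (suc N) b n j ≈
    Σ< (suc b) (λ a → expCoeff (Y i) a * when ((a ≤ᵇ j) ∧ (i ℕ.* a ≤ᵇ n)) (bellSum Y (suc i) N b (n ∸ i ℕ.* a) (j ∸ a)))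
  bellSum-suc Y i N b n j = trans (tupleSum-suc Y (hasSizeWeight i n j) i N b) (Σ<-cong (suc b) λ a _ → *-congˡ {expCoeff (Y i) a}
    (trans (tupleSum-cong Y (suc i) N b (hasSizeWeight-∷ i n j a))
           (tupleSum-∧ Y ((a ≤ᵇ j) ∧ (i ℕ.* a ≤ᵇ n)) (hasSizeWeight (suc i) (n ∸ i ℕ.* a) (j ∸ a)) (suc i) N b)))

  weightSum≈expProduct : ∀ Y j N b n → n ≤ b → weightSum Y (suc j) N b n ≈ expProduct Y j N n
  weightSum≈expProduct Y j zero b zero _ = +-identityʳ 1#
  weightSum≈expProduct Y j zero b (suc n) _ = +-identityʳ 0#
  weightSum≈expProduct Y j (suc N) b n n≤b = begin
    weightSum Y (suc j) (suc N) b n ≈⟨ weightSum-suc Y (suc j) N b n ⟩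
    Σ< (suc b) T                    ≈⟨ Σ<-truncate (suc n) (suc b) T (s≤s n≤b) vanish ⟩
    Σ< (suc n) T                    ≈⟨ Σ<-cong (suc n) (λ a a≤n → term a (ℕₚ.≤-pred a≤n)) ⟩
    Σ< (suc n) T′                   ≈⟨ sym (dilate-⊠ j 0 (expCoeff (Y (suc j))) (expProduct Y (suc j) N) n (suc n) ℕₚ.≤-refl) ⟩
    expProduct Y j (suc N) n        ∎
    where
    T = λ a → expCoeff (Y (suc j)) a * when (suc j ℕ.* a ≤ᵇ n) (weightSum Y (suc (suc j)) N b (n ∸ suc j ℕ.* a))
    T′ = λ a → when (a ℕ.* suc j ≤ᵇ n) (expCoeff (Y (suc j)) a * expProduct Y (suc j) N (n ∸ a ℕ.* suc j))
    vanish : ∀ a → suc n ≤ a → a < suc b → T a ≈ 0#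
    vanish a n<a _ rewrite ≤ᵇ-false (ℕₚ.<-≤-trans n<a (ℕₚ.m≤n*m a (suc j))) = zeroʳ _
    term : ∀ a → a ≤ n → T a ≈ T′ a
    term a a≤n = begin
      T a ≈⟨ *-when (suc j ℕ.* a ≤ᵇ n) (expCoeff (Y (suc j)) a) _ ⟩
      when (suc j ℕ.* a ≤ᵇ n) (expCoeff (Y (suc j)) a * weightSum Y (suc (suc j)) N b (n ∸ suc j ℕ.* a))
        ≈⟨ when-cong (suc j ℕ.* a ≤ᵇ n) (λ _ → *-congˡ
             (weightSum≈expProduct Y (suc j) N b (n ∸ suc j ℕ.* a) (ℕₚ.≤-trans (ℕₚ.m∸n≤m n (suc j ℕ.* a)) n≤b))) ⟩
      when (suc j ℕ.* a ≤ᵇ n) (expCoeff (Y (suc j)) a * expProduct Y (suc j) N (n ∸ suc j ℕ.* a))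
        ≡⟨ ≡.cong (λ z → when (z ≤ᵇ n) (expCoeff (Y (suc j)) a * expProduct Y (suc j) N (n ∸ z))) (ℕₚ.*-comm (suc j) a) ⟩
      T′ a ∎

  bellSum-vanish : ∀ Y i N b n j → n < i ℕ.* j → bellSum Y i N b n j ≈ 0#
  bellSum-vanish Y i N b n j n<ij = listSum-zero _ (tuples N b) (λ α → reflexive (≡.cong (λ z → when z _) (unweighable α)))
    where
    unweighable : ∀ α → hasSizeWeight i n j α ≡ false
    unweighable α with sumℕ α ℕ.≟ j | wsum i α ℕ.≟ n
    ... | no σ≢j | _ rewrite ≡ᵇ-false σ≢j = ≡.refl
    ... | yes ≡.refl | no w≢n rewrite ≡ᵇ-false w≢n = Boolₚ.∧-zeroʳ _
    ... | yes ≡.refl | yes ≡.refl = contradiction (i*sum≤wsum i α) (ℕₚ.<⇒≱ n<ij)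

  bellSum-0 : ∀ Y i N b n → bellSum Y i N b n 0 ≈ when (0 ≡ᵇ n) 1#
  bellSum-0 Y i zero b n = +-identityʳ _
  bellSum-0 Y i (suc N) b n = begin
    bellSum Y i (suc N) b n 0           ≈⟨ bellSum-suc Y i N b n 0 ⟩
    T 0 + Σ< b (T ∘ suc)                ≈⟨ +-cong first (Σ<-zero b (λ a _ → zeroʳ _)) ⟩
    when (0 ≡ᵇ n) 1# + 0#               ≈⟨ +-identityʳ _ ⟩
    when (0 ≡ᵇ n) 1#                    ∎
    where
    T = λ a → expCoeff (Y i) a * when ((a ≤ᵇ 0) ∧ (i ℕ.* a ≤ᵇ n)) (bellSum Y (suc i) N b (n ∸ i ℕ.* a) (0 ∸ a))
    first : T 0 ≈ when (0 ≡ᵇ n) 1#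
    first = begin
      T 0                                    ≡⟨ ≡.cong (λ z → expCoeff (Y i) 0 * when (z ≤ᵇ n) (bellSum Y (suc i) N b (n ∸ z) 0)) (ℕₚ.*-zeroʳ i) ⟩
      expCoeff (Y i) 0 * bellSum Y (suc i) N b n 0 ≈⟨ *-cong (expCoeff-0 (Y i)) (bellSum-0 Y (suc i) N b n) ⟩
      1# * when (0 ≡ᵇ n) 1#                  ≈⟨ *-identityˡ _ ⟩
      when (0 ≡ᵇ n) 1#                       ∎

  bellSum-bound : ∀ Y i N b b′ n j → j ≤ b → j ≤ b′ → bellSum Y i N b n j ≈ bellSum Y i N b′ n j
  bellSum-bound Y i zero b b′ n j _ _ = refl
  bellSum-bound Y i (suc N) b b′ n j j≤b j≤b′ = begin
    bellSum Y i (suc N) b n j  ≈⟨ bellSum-suc Y i N b n j ⟩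
    Σ< (suc b) (T b)           ≈⟨ Σ<-truncate (suc j) (suc b) (T b) (s≤s j≤b) (vanish b) ⟩
    Σ< (suc j) (T b)           ≈⟨ Σ<-cong (suc j) (λ a _ → *-congˡ {expCoeff (Y i) a} (when-cong ((a ≤ᵇ j) ∧ (i ℕ.* a ≤ᵇ n)) (λ _ →
                                    bellSum-bound Y (suc i) N b b′ (n ∸ i ℕ.* a) (j ∸ a)
                                      (ℕₚ.≤-trans (ℕₚ.m∸n≤m j a) j≤b) (ℕₚ.≤-trans (ℕₚ.m∸n≤m j a) j≤b′)))) ⟩
    Σ< (suc j) (T b′)          ≈⟨ Σ<-truncate (suc j) (suc b′) (T b′) (s≤s j≤b′) (vanish b′) ⟨
    Σ< (suc b′) (T b′)         ≈⟨ bellSum-suc Y i N b′ n j ⟨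
    bellSum Y i (suc N) b′ n j ∎
    where
    T = λ c a → expCoeff (Y i) a * when ((a ≤ᵇ j) ∧ (i ℕ.* a ≤ᵇ n)) (bellSum Y (suc i) N c (n ∸ i ℕ.* a) (j ∸ a))
    vanish : ∀ c a → suc j ≤ a → a < suc c → T c a ≈ 0#
    vanish c a j<a _ rewrite ≤ᵇ-false j<a = zeroʳ _

  -- A tuple of size j and weight n < i j + N cannot use its last (N+1)-th slot.
  bellSum-length : ∀ Y i N b n j → n < i ℕ.* j ℕ.+ N → bellSum Y i N b n j ≈ bellSum Y i (suc N) b n j
  bellSum-length Y i zero b n j n<ij+0 = trans (bellSum-vanish Y i 0 b n j n<ij) (sym (bellSum-vanish Y i 1 b n j n<ij))
    where n<ij = ≡.subst (n <_) (ℕₚ.+-identityʳ (i ℕ.* j)) n<ij+0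
  bellSum-length Y i (suc N) b n j n< = begin
    bellSum Y i (suc N) b n j       ≈⟨ bellSum-suc Y i N b n j ⟩
    Σ< (suc b) (T N)                ≈⟨ Σ<-cong (suc b) (λ a _ → *-congˡ {expCoeff (Y i) a} (when-cong ((a ≤ᵇ j) ∧ (i ℕ.* a ≤ᵇ n)) (tail a))) ⟩
    Σ< (suc b) (T (suc N))          ≈⟨ bellSum-suc Y i (suc N) b n j ⟨
    bellSum Y i (suc (suc N)) b n j ∎
    where
    T = λ M a → expCoeff (Y i) a * when ((a ≤ᵇ j) ∧ (i ℕ.* a ≤ᵇ n)) (bellSum Y (suc i) M b (n ∸ i ℕ.* a) (j ∸ a))
    tail : ∀ a → ((a ≤ᵇ j) ∧ (i ℕ.* a ≤ᵇ n)) ≡ true →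
           bellSum Y (suc i) N b (n ∸ i ℕ.* a) (j ∸ a) ≈ bellSum Y (suc i) (suc N) b (n ∸ i ℕ.* a) (j ∸ a)
    tail a guard with a ℕ.≟ j | ≤ᵇ-true⁻ {a} {j} (proj₁ (∧-true⁻ guard)) | ≤ᵇ-true⁻ {i ℕ.* a} {n} (proj₂ (∧-true⁻ guard))
    ... | yes ≡.refl | _ | _ rewrite ℕₚ.n∸n≡0 a =
      trans (bellSum-0 Y (suc i) N b (n ∸ i ℕ.* a)) (sym (bellSum-0 Y (suc i) (suc N) b (n ∸ i ℕ.* a)))
    ... | no a≢j | a≤j | ia≤n =
      bellSum-length Y (suc i) N b (n ∸ i ℕ.* a) (j ∸ a) (n∸i*a<[1+i]*[j∸a]+N {i} {j} {a} {n} {N} (ℕₚ.≤∧≢⇒< a≤j a≢j) ia≤n n<)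

  bellSum-length+ : ∀ Y i N d b n j → n < i ℕ.* j ℕ.+ N → bellSum Y i N b n j ≈ bellSum Y i (N ℕ.+ d) b n j
  bellSum-length+ Y i N zero b n j _ rewrite ℕₚ.+-identityʳ N = refl
  bellSum-length+ Y i N (suc d) b n j n< rewrite ℕₚ.+-suc N d =
    trans (bellSum-length Y i N b n j n<) (bellSum-length+ Y i (suc N) d b n j (ℕₚ.<-≤-trans n< (ℕₚ.+-monoʳ-≤ (i ℕ.* j) (ℕₚ.n≤1+n N))))

  listSum-sizes : ∀ s σ F → 1 ≤ σ → σ ≤ s → listSum (map (λ j → when (σ ≡ᵇ j) F) (map suc (upTo s))) ≈ F
  listSum-sizes s (suc σ) F _ σ<s = begin
    listSum (map (λ j → when (suc σ ≡ᵇ j) F) (map suc (upTo s))) ≡⟨ ≡.cong listSum (Listₚ.map-∘ (upTo s)) ⟨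
    listSum (map (λ j → when (σ ≡ᵇ j) F) (upTo s))              ≈⟨ listSum-applyUpTo s (λ j → when (σ ≡ᵇ j) F) (λ j → j) ⟩
    Σ< s (λ j → when (σ ≡ᵇ j) F)                                ≈⟨ Σ<-cong s (λ j _ → reflexive (≡.cong (λ b → when b F) (≡ᵇ-comm σ j))) ⟩
    Σ< s (λ j → when (j ≡ᵇ σ) F)                                ≈⟨ Σ<-delta s σ (λ _ → F) ⟩
    when (σ ℕ.<ᵇ s) F                                           ≡⟨ ≡.cong (λ b → when b F) (≤ᵇ-true σ<s) ⟩
    F                                                           ∎

  Σ-bellSum≈weightSum : ∀ Y s → 1 ≤ s → listSum (map (bellSum Y 1 s s s) (map suc (upTo s))) ≈ weightSum Y 1 s s s
  Σ-bellSum≈weightSum Y s 1≤s =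
    trans (listSum-swap (λ j α → when (hasSizeWeight 1 s j α) (tupleTerm Y 1 α)) (map suc (upTo s)) (tuples s s))
          (listSum-cong (tuples s s) sizes)
    where
    sizes : ∀ α → listSum (map (λ j → when (hasSizeWeight 1 s j α) (tupleTerm Y 1 α)) (map suc (upTo s)))
                  ≈ when (hasWeight 1 s α) (tupleTerm Y 1 α)
    sizes α with wsum 1 α ℕ.≟ s
    ... | no w≢s rewrite ≡ᵇ-false w≢s =
      listSum-zero _ (map suc (upTo s)) (λ j → reflexive (≡.cong (λ b → when b _) (Boolₚ.∧-zeroʳ (sumℕ α ≡ᵇ j))))
    ... | yes w≡s rewrite ≡ᵇ-true w≡s = begin
      listSum (map (λ j → when ((sumℕ α ≡ᵇ j) ∧ true) (tupleTerm Y 1 α)) (map suc (upTo s)))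
        ≈⟨ listSum-cong (map suc (upTo s)) (λ j → reflexive (≡.cong (λ b → when b _) (Boolₚ.∧-identityʳ (sumℕ α ≡ᵇ j)))) ⟩
      listSum (map (λ j → when (sumℕ α ≡ᵇ j) (tupleTerm Y 1 α)) (map suc (upTo s)))
        ≈⟨ listSum-sizes s (sumℕ α) (tupleTerm Y 1 α) 1≤σ σ≤s ⟩
      tupleTerm Y 1 α ∎
      where
      σ≤s : sumℕ α ≤ s
      σ≤s = ≡.subst₂ _≤_ (ℕₚ.*-identityˡ (sumℕ α)) w≡s (i*sum≤wsum 1 α)
      1≤σ : 1 ≤ sumℕ α
      1≤σ with sumℕ α ℕ.≟ 0
      ... | yes σ≡0 = contradiction (≡.trans (≡.sym w≡s) (sum≡0⇒wsum≡0 1 α σ≡0)) (ℕₚ.>⇒≢ 1≤s)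
      ... | no σ≢0 = ℕₚ.n≢0⇒n>0 σ≢0

  rescaled : (ℕ → PS) → ℕ → PS
  rescaled x i = scale (invFact i) (x i)

  invFactProduct : List ℕ → ℚ
  invFactProduct = foldr (λ a r → invFact a ℚ.* r) 1ℚ

  scale-sumPS : ∀ c {A : Set} (G : A → PS) xs → scale c (sumPS (map G xs)) ≈ listSum (map (scale c ∘ G) xs)
  scale-sumPS c G xs = ℚS.mk≈ λ q _ → pointwise xs q
    where
    pointwise : ∀ xs q → scale c (sumPS (map G xs)) q ≡ listSum (map (scale c ∘ G) xs) q
    pointwise [] q = ℚₚ.*-zeroʳ c
    pointwise (a ∷ xs) q = ≡.trans (ℚₚ.*-distribˡ-+ c (G a q) _) (≡.cong (c ℚ.* G a q ℚ.+_) (pointwise xs q))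

  scale-if : ∀ c b X → scale c (if b then X else zeroPS) ≈ when b (scale c X)
  scale-if c true X = refl
  scale-if c false X = ℚS.mk≈ λ _ _ → ℚₚ.*-zeroʳ c

  bellProd≈tupleTerm : ∀ x i α → scale (invFactProduct α) (bellProd x i α) ≈ tupleTerm (rescaled x) i α
  bellProd≈tupleTerm x i [] = ℚS.mk≈ λ q _ → ≡.trans (ℚₚ.*-identityˡ _) (onePS≡𝟙 q)
  bellProd≈tupleTerm x i (a ∷ α) = trans (ℚS.mk≈ λ q _ → split q) (*-cong power (bellProd≈tupleTerm x (suc i) α))
    where
    c = invFact a
    r = invFactProduct α
    A = pow (rescaled x i) a
    B = bellProd x (suc i) α
    split : ∀ q → scale (c ℚ.* r) (A ⊗ B) q ≡ (scale c A ℚS.⊠ scale r B) q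
    split q = ≡.sym (≡.trans (ℚS.⊠-scalarˡ c A (scale r B) q) (≡.trans (≡.cong (c ℚ.*_) (ℚS.⊠-scalarʳ r A B q))
      (≡.trans (≡.sym (ℚₚ.*-assoc c r _)) (≡.cong ((c ℚ.* r) ℚ.*_) (≡.sym (⊗≡⊠ A B q))))))
    power : scale c A ≈ expCoeff (rescaled x i) a
    power = ℚS.mk≈ λ q _ → ≡.trans (≡.cong (c ℚ.*_) (pow≡^ (rescaled x i) a q)) (≡.sym (⊠-const c _ q))

  scaled-Bell≈bellSum : ∀ x s j → scale (invFact s) (Bell s j x) ≈ bellSum (rescaled x) 1 (suc (s ∸ j)) j s j
  scaled-Bell≈bellSum x s j = trans (scale-sumPS (invFact s) _ (tuples (suc (s ∸ j)) j))
    (listSum-cong (tuples (suc (s ∸ j)) j) (λ α → trans (scale-if (invFact s) (hasSizeWeight 1 s j α) _)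
       (when-cong (hasSizeWeight 1 s j α) (λ _ → trans (ℚS.mk≈ λ q _ → coefficient α q) (bellProd≈tupleTerm x 1 α)))))
    where
    coefficient : ∀ α q → invFact s ℚ.* (bellCoeff s α ℚ.* bellProd x 1 α q) ≡ invFactProduct α ℚ.* bellProd x 1 α q
    coefficient α q = ≡.trans (≡.sym (ℚₚ.*-assoc (invFact s) _ _)) (≡.cong (ℚ._* bellProd x 1 α q)
      (≡.trans (≡.sym (ℚₚ.*-assoc (invFact s) (fromℕ (s !)) _))
        (≡.trans (≡.cong (ℚ._* invFactProduct α) (invFact*fromℕ! s)) (ℚₚ.*-identityˡ (invFactProduct α)))))

  scaled-Bell≈bellSum-uniform : ∀ x s j → j < s → scale (invFact s) (Bell s (suc j) x) ≈ bellSum (rescaled x) 1 s s s (suc j)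
  scaled-Bell≈bellSum-uniform x s j j<s = begin
    scale (invFact s) (Bell s (suc j) x)                 ≈⟨ scaled-Bell≈bellSum x s (suc j) ⟩
    bellSum Y 1 (suc (s ∸ suc j)) (suc j) s (suc j)      ≈⟨ bellSum-length+ Y 1 (suc (s ∸ suc j)) j (suc j) s (suc j) s< ⟩
    bellSum Y 1 (suc (s ∸ suc j) ℕ.+ j) (suc j) s (suc j) ≡⟨ ≡.cong (λ N → bellSum Y 1 N (suc j) s (suc j)) tuple-length ⟩
    bellSum Y 1 s (suc j) s (suc j)                      ≈⟨ bellSum-bound Y 1 s (suc j) s s (suc j) ℕₚ.≤-refl j<s ⟩
    bellSum Y 1 s s s (suc j)                            ∎
    where
    Y = rescaled x
    s∸j+j : suc j ℕ.+ (s ∸ suc j) ≡ s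
    s∸j+j = ℕₚ.m+[n∸m]≡n j<s
    tuple-length : suc (s ∸ suc j) ℕ.+ j ≡ s
    tuple-length = ≡.trans (≡.cong suc (ℕₚ.+-comm (s ∸ suc j) j)) s∸j+j
    s< : s < 1 ℕ.* suc j ℕ.+ suc (s ∸ suc j)
    s< = ≡.subst (s <_) (≡.sym (≡.trans (≡.cong (ℕ._+ suc (s ∸ suc j)) (ℕₚ.*-identityˡ (suc j)))
           (≡.trans (ℕₚ.+-suc (suc j) (s ∸ suc j)) (≡.cong suc s∸j+j)))) (ℕₚ.n<1+n s)

  Bell≈expProduct : ∀ x s → 1 ≤ s →
    scale (invFact s) (sumPS (map (λ j → Bell s j x) (map suc (upTo s)))) ≈ expProduct (rescaled x) 0 s s
  Bell≈expProduct x s 1≤s = begin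
    scale (invFact s) (sumPS (map (λ j → Bell s j x) (map suc (upTo s))))
      ≈⟨ scale-sumPS (invFact s) (λ j → Bell s j x) (map suc (upTo s)) ⟩
    listSum (map (λ j → scale (invFact s) (Bell s j x)) (map suc (upTo s)))
      ≡⟨ ≡.cong listSum (Listₚ.map-∘ (upTo s)) ⟨
    listSum (map (λ j → scale (invFact s) (Bell s (suc j) x)) (upTo s))
      ≈⟨ listSum-applyUpTo s _ (λ j → j) ⟩
    Σ< s (λ j → scale (invFact s) (Bell s (suc j) x))
      ≈⟨ Σ<-cong s (scaled-Bell≈bellSum-uniform x s) ⟩
    Σ< s (λ j → bellSum Y 1 s s s (suc j))
      ≈⟨ listSum-applyUpTo s _ (λ j → j) ⟨
    listSum (map (λ j → bellSum Y 1 s s s (suc j)) (upTo s))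
      ≡⟨ ≡.cong listSum (Listₚ.map-∘ (upTo s)) ⟩
    listSum (map (bellSum Y 1 s s s) (map suc (upTo s)))
      ≈⟨ Σ-bellSum≈weightSum Y s 1≤s ⟩
    weightSum Y 1 s s s
      ≈⟨ weightSum≈expProduct Y 0 s s s ℕₚ.≤-refl ⟩
    expProduct Y 0 s s ∎
    where
    Y = rescaled x

module TreeBasics where

  mutual
    _≟ᵀ_ : (x y : Tree) → Dec (x ≡ y)
    node xs ≟ᵀ node ys with xs ≟ᵀˢ ys
    ... | yes ≡.refl = yes ≡.refl
    ... | no xs≢ys = no λ { ≡.refl → xs≢ys ≡.refl }

    _≟ᵀˢ_ : (xs ys : List Tree) → Dec (xs ≡ ys)
    [] ≟ᵀˢ [] = yes ≡.refl
    [] ≟ᵀˢ (y ∷ ys) = no λ ()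
    (x ∷ xs) ≟ᵀˢ [] = no λ ()
    (x ∷ xs) ≟ᵀˢ (y ∷ ys) with x ≟ᵀ y | xs ≟ᵀˢ ys
    ... | yes ≡.refl | yes ≡.refl = yes ≡.refl
    ... | no x≢y | _ = no λ { ≡.refl → x≢y ≡.refl }
    ... | yes _ | no xs≢ys = no λ { ≡.refl → xs≢ys ≡.refl }

  node-injective : ∀ {xs ys} → Tree.node xs ≡ Tree.node ys → xs ≡ ys
  node-injective ≡.refl = ≡.refl

  mutual
    ≅-refl : ∀ t → t ≅ t
    ≅-refl (node xs) = node ↭.refl (Pointwise-≅-refl xs)

    Pointwise-≅-refl : ∀ xs → Pointwise _≅_ xs xs
    Pointwise-≅-refl [] = []
    Pointwise-≅-refl (x ∷ xs) = ≅-refl x ∷ Pointwise-≅-refl xs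

  Pointwise-↭-commute : ∀ {R : Tree → Tree → Set} {xs ys zs} → Pointwise R xs ys → ys ↭ zs →
                        ∃ λ ws → (xs ↭ ws) × Pointwise R ws zs
  Pointwise-↭-commute rs ↭.refl = _ , ↭.refl , rs
  Pointwise-↭-commute (r ∷ rs) (↭.prep y p) with Pointwise-↭-commute rs p
  ... | _ , q , rs′ = _ , ↭.prep _ q , r ∷ rs′
  Pointwise-↭-commute (r₁ ∷ r₂ ∷ rs) (↭.swap _ _ p) with Pointwise-↭-commute rs p
  ... | _ , q , rs′ = _ , ↭.swap _ _ q , r₂ ∷ r₁ ∷ rs′
  Pointwise-↭-commute rs (↭.trans p₁ p₂) with Pointwise-↭-commute rs p₁
  ... | _ , q₁ , rs₁ with Pointwise-↭-commute rs₁ p₂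
  ...   | _ , q₂ , rs₂ = _ , ↭.trans q₁ q₂ , rs₂

  1≤leaves : ∀ t → 1 ≤ leaves t
  1≤leaves (node []) = s≤s z≤n
  1≤leaves (node (x ∷ xs)) = ℕₚ.≤-trans (1≤leaves x) (ℕₚ.m≤m+n (leaves x) (leavesL xs))

  leaves-suc : ∀ t → ∃ λ m → leaves t ≡ suc m
  leaves-suc t with leaves t | 1≤leaves t
  ... | suc m | _ = m , ≡.refl

  leavesL-++ : ∀ xs ys → leavesL (xs ++ ys) ≡ leavesL xs ℕ.+ leavesL ys
  leavesL-++ [] ys = ≡.refl
  leavesL-++ (x ∷ xs) ys = ≡.trans (≡.cong (leaves x ℕ.+_) (leavesL-++ xs ys)) (≡.sym (ℕₚ.+-assoc (leaves x) _ _))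

  innerL-++ : ∀ xs ys → innerL (xs ++ ys) ≡ innerL xs ℕ.+ innerL ys
  innerL-++ [] ys = ≡.refl
  innerL-++ (x ∷ xs) ys = ≡.trans (≡.cong (inner x ℕ.+_) (innerL-++ xs ys)) (≡.sym (ℕₚ.+-assoc (inner x) _ _))

  leavesL-replicate : ∀ a r → leavesL (replicate a r) ≡ a ℕ.* leaves r
  leavesL-replicate zero r = ≡.refl
  leavesL-replicate (suc a) r = ≡.cong (leaves r ℕ.+_) (leavesL-replicate a r)

  innerL-replicate : ∀ a r → innerL (replicate a r) ≡ a ℕ.* inner r
  innerL-replicate zero r = ≡.refl
  innerL-replicate (suc a) r = ≡.cong (inner r ℕ.+_) (innerL-replicate a r)

  leavesL-↭ : ∀ {xs ys} → xs ↭ ys → leavesL xs ≡ leavesL ys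
  leavesL-↭ ↭.refl = ≡.refl
  leavesL-↭ (↭.prep x p) = ≡.cong (leaves x ℕ.+_) (leavesL-↭ p)
  leavesL-↭ (↭.swap x y p) = ≡.trans (≡.sym (ℕₚ.+-assoc (leaves x) (leaves y) _))
    (≡.trans (≡.cong₂ ℕ._+_ (ℕₚ.+-comm (leaves x) (leaves y)) (leavesL-↭ p)) (ℕₚ.+-assoc (leaves y) (leaves x) _))
  leavesL-↭ (↭.trans p q) = ≡.trans (leavesL-↭ p) (leavesL-↭ q)

  innerL-↭ : ∀ {xs ys} → xs ↭ ys → innerL xs ≡ innerL ys
  innerL-↭ ↭.refl = ≡.refl
  innerL-↭ (↭.prep x p) = ≡.cong (inner x ℕ.+_) (innerL-↭ p)
  innerL-↭ (↭.swap x y p) = ≡.trans (≡.sym (ℕₚ.+-assoc (inner x) (inner y) _))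
    (≡.trans (≡.cong₂ ℕ._+_ (ℕₚ.+-comm (inner x) (inner y)) (innerL-↭ p)) (ℕₚ.+-assoc (inner y) (inner x) _))
  innerL-↭ (↭.trans p q) = ≡.trans (innerL-↭ p) (innerL-↭ q)

  mutual
    Pointwise-≅-leavesL : ∀ {xs ys} → Pointwise _≅_ xs ys → leavesL xs ≡ leavesL ys
    Pointwise-≅-leavesL [] = ≡.refl
    Pointwise-≅-leavesL (r ∷ rs) = ≡.cong₂ ℕ._+_ (≅-leaves r) (Pointwise-≅-leavesL rs)

    ≅-leaves : ∀ {t u} → t ≅ u → leaves t ≡ leaves u
    ≅-leaves (node {[]} p []) with ↭ₚ.↭-empty-inv (↭-sym p)
    ... | ≡.refl = ≡.refl
    ≅-leaves (node {x ∷ xs} p []) with ↭ₚ.↭-length p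
    ... | ()
    ≅-leaves (node {[]} p (_ ∷ _)) with ↭ₚ.↭-length p
    ... | ()
    ≅-leaves (node {x ∷ xs} p (r ∷ rs)) = ≡.trans (leavesL-↭ p) (Pointwise-≅-leavesL (r ∷ rs))

  mutual
    Pointwise-≅-innerL : ∀ {xs ys} → Pointwise _≅_ xs ys → innerL xs ≡ innerL ys
    Pointwise-≅-innerL [] = ≡.refl
    Pointwise-≅-innerL (r ∷ rs) = ≡.cong₂ ℕ._+_ (≅-inner r) (Pointwise-≅-innerL rs)

    ≅-inner : ∀ {t u} → t ≅ u → inner t ≡ inner u
    ≅-inner (node {[]} p []) with ↭ₚ.↭-empty-inv (↭-sym p)
    ... | ≡.refl = ≡.refl
    ≅-inner (node {x ∷ xs} p []) with ↭ₚ.↭-length p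
    ... | ()
    ≅-inner (node {[]} p (_ ∷ _)) with ↭ₚ.↭-length p
    ... | ()
    ≅-inner (node {x ∷ xs} p (r ∷ rs)) = ≡.cong suc (≡.trans (innerL-↭ p) (Pointwise-≅-innerL (r ∷ rs)))

module Multisets where

  open TreeBasics

  multiplicity : Tree → List Tree → ℕ
  multiplicity r = length ∘ filter (_≟ᵀ r)

  multiplicity-↭ : ∀ r {xs ys} → xs ↭ ys → multiplicity r xs ≡ multiplicity r ys
  multiplicity-↭ r p = ↭ₚ.↭-length (↭ₚ.filter-↭ (_≟ᵀ r) p)

  multiplicity-++ : ∀ r xs ys → multiplicity r (xs ++ ys) ≡ multiplicity r xs ℕ.+ multiplicity r ys
  multiplicity-++ r xs ys = ≡.trans (≡.cong length (Listₚ.filter-++ (_≟ᵀ r) xs ys)) (Listₚ.length-++ (filter (_≟ᵀ r) xs))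

  multiplicity-replicate : ∀ r a → multiplicity r (replicate a r) ≡ a
  multiplicity-replicate r a =
    ≡.trans (≡.cong length (Listₚ.filter-all (_≟ᵀ r) (Allₚ.replicate⁺ a ≡.refl))) (Listₚ.length-replicate a)

  multiplicity-absent : ∀ r {M} → All (r ≢_) M → multiplicity r M ≡ 0
  multiplicity-absent r r∉M = ≡.cong length (Listₚ.filter-none (_≟ᵀ r) (All.map (_∘ ≡.sym) r∉M))

  fits : Tree → ℕ → ℕ → ℕ → Bool
  fits r s k a = (a ℕ.* leaves r ≤ᵇ s) ∧ (a ℕ.* inner r ≤ᵇ k)

  -- multisets R s k lists each multiset over R with s leaves and k inner vertices in total exactly once,
  -- as the list r₁^a₁ ++ r₂^a₂ ++ ⋯ for R = r₁ ∷ r₂ ∷ ⋯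
  mutual
    multisets : List Tree → ℕ → ℕ → List (List Tree)
    multisets [] s k = if (s ≡ᵇ 0) ∧ (k ≡ᵇ 0) then [] ∷ [] else []
    multisets (r ∷ R) s k = concatMap (withCopies r R s k) (upTo (suc s))

    withCopies : Tree → List Tree → ℕ → ℕ → ℕ → List (List Tree)
    withCopies r R s k a =
      if fits r s k a then map (replicate a r ++_) (multisets R (s ∸ a ℕ.* leaves r) (k ∸ a ℕ.* inner r)) else []

  ∈-if⁻ : ∀ {A : Set} b {xs : List A} {y} → y ∈ (if b then xs else []) → (b ≡ true) × y ∈ xs
  ∈-if⁻ true y∈xs = ≡.refl , y∈xs

  record Decomposition (r : Tree) (R : List Tree) (s k : ℕ) (M : List Tree) : Set where
    constructor decomposition
    field
      copies : ℕ
      rest : List Tree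
      copies-leaves≤ : copies ℕ.* leaves r ≤ s
      copies-inner≤ : copies ℕ.* inner r ≤ k
      M≡ : M ≡ replicate copies r ++ rest
      rest∈ : rest ∈ multisets R (s ∸ copies ℕ.* leaves r) (k ∸ copies ℕ.* inner r)

  ∈-multisets-∷⁻ : ∀ r R s k {M} → M ∈ multisets (r ∷ R) s k → Decomposition r R s k M
  ∈-multisets-∷⁻ r R s k M∈ with find (∈ₚ.∈-concatMap⁻ (withCopies r R s k) {upTo (suc s)} M∈)
  ... | a , _ , M∈′ with ∈-if⁻ (fits r s k a) M∈′
  ...   | fit , M∈″ with ∈ₚ.∈-map⁻ (replicate a r ++_) M∈″
  ...     | rest , rest∈ , M≡ with ∧-true⁻ fit
  ...       | leaves-fit , inner-fit = decomposition a rest (≤ᵇ-true⁻ leaves-fit) (≤ᵇ-true⁻ inner-fit) M≡ rest∈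

  ∈-multisets-∷⁺ : ∀ r R s k a {rest} → a ℕ.* leaves r ≤ s → a ℕ.* inner r ≤ k →
    rest ∈ multisets R (s ∸ a ℕ.* leaves r) (k ∸ a ℕ.* inner r) → replicate a r ++ rest ∈ multisets (r ∷ R) s k
  ∈-multisets-∷⁺ r R s k a leaves≤ inner≤ rest∈ = ∈ₚ.∈-concatMap⁺ (withCopies r R s k) (lose (∈ₚ.∈-upTo⁺ (s≤s a≤s)) withCopies∋)
    where
    a≤s : a ≤ s
    a≤s = ℕₚ.≤-trans (ℕₚ.m≤m*n a (leaves r) {{ℕ.>-nonZero (1≤leaves r)}}) leaves≤
    withCopies∋ : replicate a r ++ _ ∈ withCopies r R s k a
    withCopies∋ rewrite ≤ᵇ-true leaves≤ | ≤ᵇ-true inner≤ = ∈ₚ.∈-map⁺ (replicate a r ++_) rest∈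

  ∈-multisets-[]⁻ : ∀ s k {M} → M ∈ multisets [] s k → (M ≡ []) × (s ≡ 0) × (k ≡ 0)
  ∈-multisets-[]⁻ s k M∈ with ∈-if⁻ ((s ≡ᵇ 0) ∧ (k ≡ᵇ 0)) M∈
  ... | fit , here ≡.refl with ∧-true⁻ fit
  ...   | s≡ᵇ0 , k≡ᵇ0 = ≡.refl , ≡ᵇ-true⁻ s≡ᵇ0 , ≡ᵇ-true⁻ k≡ᵇ0

  multisets-sound : ∀ R s k {M} → M ∈ multisets R s k → All (_∈ R) M × (leavesL M ≡ s) × (innerL M ≡ k)
  multisets-sound [] s k M∈ with ∈-multisets-[]⁻ s k M∈
  ... | ≡.refl , ≡.refl , ≡.refl = [] , ≡.refl , ≡.refl
  multisets-sound (r ∷ R) s k M∈ with ∈-multisets-∷⁻ r R s k M∈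
  ... | decomposition a rest leaves≤ inner≤ ≡.refl rest∈ with multisets-sound R _ _ rest∈
  ...   | rest⊆R , leaves≡ , inner≡ =
    Allₚ.++⁺ (Allₚ.replicate⁺ a (here ≡.refl)) (All.map there rest⊆R) ,
    ≡.trans (leavesL-++ (replicate a r) rest) (≡.trans (≡.cong₂ ℕ._+_ (leavesL-replicate a r) leaves≡) (ℕₚ.m+[n∸m]≡n leaves≤)) ,
    ≡.trans (innerL-++ (replicate a r) rest) (≡.trans (≡.cong₂ ℕ._+_ (innerL-replicate a r) inner≡) (ℕₚ.m+[n∸m]≡n inner≤))

  extractCopies : ∀ r R L → All (_∈ r ∷ R) L → ∃ λ a → ∃ λ L′ → All (_∈ R) L′ × (L ↭ replicate a r ++ L′)
  extractCopies r R [] [] = 0 , [] , [] , ↭.refl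
  extractCopies r R (x ∷ L) (x∈ ∷ L⊆) with extractCopies r R L L⊆ | x ≟ᵀ r | x∈
  ... | a , L′ , L′⊆ , p | yes ≡.refl | _ = suc a , L′ , L′⊆ , ↭.prep r p
  ... | a , L′ , L′⊆ , p | no x≢r | here x≡r = contradiction x≡r x≢r
  ... | a , L′ , L′⊆ , p | no x≢r | there x∈R =
    a , x ∷ L′ , x∈R ∷ L′⊆ , ↭.trans (↭.prep x p) (↭-sym (↭ₚ.shift x (replicate a r) L′))

  multisets-complete : ∀ R L → All (_∈ R) L → ∃ λ M → M ∈ multisets R (leavesL L) (innerL L) × (L ↭ M)
  multisets-complete [] [] [] = [] , here ≡.refl , ↭.refl
  multisets-complete (r ∷ R) L L⊆ with extractCopies r R L L⊆
  ... | a , L′ , L′⊆ , p with multisets-complete R L′ L′⊆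
  ...   | M′ , M′∈ , q = replicate a r ++ M′ ,
    ∈-multisets-∷⁺ r R (leavesL L) (innerL L) a (≡.subst (a ℕ.* leaves r ≤_) (≡.sym leaves≡) (ℕₚ.m≤m+n _ _))
      (≡.subst (a ℕ.* inner r ≤_) (≡.sym inner≡) (ℕₚ.m≤m+n _ _))
      (≡.subst₂ (λ u v → M′ ∈ multisets R u v)
        (≡.sym (≡.trans (≡.cong (_∸ a ℕ.* leaves r) leaves≡) (ℕₚ.m+n∸m≡n (a ℕ.* leaves r) _)))
        (≡.sym (≡.trans (≡.cong (_∸ a ℕ.* inner r) inner≡) (ℕₚ.m+n∸m≡n (a ℕ.* inner r) _))) M′∈) ,
    ↭.trans p (↭ₚ.++⁺ˡ (replicate a r) q)
    where
    leaves≡ : leavesL L ≡ a ℕ.* leaves r ℕ.+ leavesL L′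
    leaves≡ = ≡.trans (leavesL-↭ p) (≡.trans (leavesL-++ (replicate a r) L′) (≡.cong (ℕ._+ leavesL L′) (leavesL-replicate a r)))
    inner≡ : innerL L ≡ a ℕ.* inner r ℕ.+ innerL L′
    inner≡ = ≡.trans (innerL-↭ p) (≡.trans (innerL-++ (replicate a r) L′) (≡.cong (ℕ._+ innerL L′) (innerL-replicate a r)))

  multiplicity-copies : ∀ r R → All (r ≢_) R → ∀ s k a {rest} →
    rest ∈ multisets R (s ∸ a ℕ.* leaves r) (k ∸ a ℕ.* inner r) → multiplicity r (replicate a r ++ rest) ≡ a
  multiplicity-copies r R r∉R s k a {rest} rest∈ = begin
    multiplicity r (replicate a r ++ rest)                    ≡⟨ multiplicity-++ r (replicate a r) rest ⟩
    multiplicity r (replicate a r) ℕ.+ multiplicity r rest    ≡⟨ ≡.cong₂ ℕ._+_ (multiplicity-replicate r a) r∉rest ⟩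
    a ℕ.+ 0                                                   ≡⟨ ℕₚ.+-identityʳ a ⟩
    a                                                         ∎
    where
    open ≡.≡-Reasoning
    r∉rest = multiplicity-absent r (All.map (All.lookup r∉R) (proj₁ (multisets-sound R _ _ rest∈)))

  multisets-multiplicity-injective : ∀ R → Unique R → ∀ s k {M₁ M₂} → M₁ ∈ multisets R s k → M₂ ∈ multisets R s k →
    (∀ x → multiplicity x M₁ ≡ multiplicity x M₂) → M₁ ≡ M₂
  multisets-multiplicity-injective [] _ s k M₁∈ M₂∈ _ with ∈-multisets-[]⁻ s k M₁∈ | ∈-multisets-[]⁻ s k M₂∈
  ... | ≡.refl , _ | ≡.refl , _ = ≡.refl
  multisets-multiplicity-injective (r ∷ R) (r∉R ∷ R-unique) s k M₁∈ M₂∈ same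
    with ∈-multisets-∷⁻ r R s k M₁∈ | ∈-multisets-∷⁻ r R s k M₂∈
  ... | decomposition a₁ rest₁ _ _ ≡.refl rest₁∈ | decomposition a₂ rest₂ _ _ ≡.refl rest₂∈
    with ≡.trans (≡.sym (multiplicity-copies r R r∉R s k a₁ rest₁∈)) (≡.trans (same r) (multiplicity-copies r R r∉R s k a₂ rest₂∈))
  ...   | ≡.refl = ≡.cong (replicate a₁ r ++_) (multisets-multiplicity-injective R R-unique _ _ rest₁∈ rest₂∈ λ x →
          ℕₚ.+-cancelˡ-≡ (multiplicity x (replicate a₁ r)) (multiplicity x rest₁) (multiplicity x rest₂)
            (≡.trans (≡.sym (multiplicity-++ x (replicate a₁ r) rest₁)) (≡.trans (same x) (multiplicity-++ x (replicate a₁ r) rest₂))))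

  unique-concatMap : ∀ {A B : Set} (g : A → List B) (f : B → A) xs → Unique xs → (∀ {a} → a ∈ xs → Unique (g a)) →
                     (∀ {a y} → a ∈ xs → y ∈ g a → f y ≡ a) → Unique (concatMap g xs)
  unique-concatMap g f [] _ _ _ = []
  unique-concatMap g f (a ∷ xs) (a∉xs ∷ xs-unique) g-unique f-inverse =
    Uniqueₚ.++⁺ (g-unique (here ≡.refl)) (unique-concatMap g f xs xs-unique (g-unique ∘ there) (f-inverse ∘ there)) disjoint
    where
    disjoint : ∀ {y} → y ∈ g a × y ∈ concatMap g xs → ⊥
    disjoint (y∈ga , y∈rest) with find (∈ₚ.∈-concatMap⁻ g {xs} y∈rest)
    ... | b , b∈xs , y∈gb = All.lookup a∉xs b∈xs (≡.trans (≡.sym (f-inverse (here ≡.refl) y∈ga)) (f-inverse (there b∈xs) y∈gb))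

  unique-if : ∀ {A : Set} b {xs : List A} → Unique xs → Unique (if b then xs else [])
  unique-if true xs-unique = xs-unique
  unique-if false _ = []

  multisets-unique : ∀ R → Unique R → ∀ s k → Unique (multisets R s k)
  multisets-unique [] _ s k with (s ≡ᵇ 0) ∧ (k ≡ᵇ 0)
  ... | true = [] ∷ []
  ... | false = []
  multisets-unique (r ∷ R) (r∉R ∷ R-unique) s k =
    unique-concatMap (withCopies r R s k) (multiplicity r) (upTo (suc s)) (Uniqueₚ.upTo⁺ (suc s))
      (λ {a} _ → unique-if (fits r s k a) (Uniqueₚ.map⁺ (Listₚ.++-cancelˡ (replicate a r) _ _) (multisets-unique R R-unique _ _)))
      copies
    where
    copies : ∀ {a M} → a ∈ upTo (suc s) → M ∈ withCopies r R s k a → multiplicity r M ≡ a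
    copies {a} _ M∈ with ∈-if⁻ (fits r s k a) M∈
    ... | _ , M∈′ with ∈ₚ.∈-map⁻ (replicate a r ++_) M∈′
    ...   | rest , rest∈ , ≡.refl = multiplicity-copies r R r∉R s k a rest∈

  length-multisets-∷ : ∀ r R s k → length (multisets (r ∷ R) s k) ≡
    ℕΣ.Σ< (suc s) (λ a → ℕΣ.when (fits r s k a) (length (multisets R (s ∸ a ℕ.* leaves r) (k ∸ a ℕ.* inner r))))
  length-multisets-∷ r R s k = ≡.trans (length-concatMap (suc s) (λ a → a)) (ℕΣ.Σ<-cong (suc s) λ a _ → length-withCopies a)
    where
    length-concatMap : ∀ n h → length (concatMap (withCopies r R s k) (applyUpTo h n)) ≡ ℕΣ.Σ< n (length ∘ withCopies r R s k ∘ h)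
    length-concatMap zero h = ≡.refl
    length-concatMap (suc n) h =
      ≡.trans (Listₚ.length-++ (withCopies r R s k (h 0))) (≡.cong (length (withCopies r R s k (h 0)) ℕ.+_) (length-concatMap n (h ∘ suc)))
    length-withCopies : ∀ a → length (withCopies r R s k a) ≡
      ℕΣ.when (fits r s k a) (length (multisets R (s ∸ a ℕ.* leaves r) (k ∸ a ℕ.* inner r)))
    length-withCopies a with fits r s k a
    ... | true = Listₚ.length-map (replicate a r ++_) (multisets R (s ∸ a ℕ.* leaves r) (k ∸ a ℕ.* inner r))
    ... | false = ≡.refl

module Representatives where

  open import Data.Fin using (Fin; zero; suc)

  open TreeBasics
  open Multisets

  -- Fuel f suffices for s ≤ f + 1: the children of a Good (2+s) (1+k) tree have at most 1+s leaves each.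
  mutual
    representatives : ℕ → ℕ → ℕ → List Tree
    representatives f zero k = []
    representatives f (suc zero) zero = node [] ∷ []
    representatives f (suc zero) (suc k) = []
    representatives f (suc (suc s)) zero = []
    representatives zero (suc (suc s)) (suc k) = []
    representatives (suc f) (suc (suc s)) (suc k) = map node (multisets (smallerRepresentatives f (suc s) k) (suc (suc s)) k)

    smallerRepresentatives : ℕ → ℕ → ℕ → List Tree
    smallerRepresentatives f m k = concatMap (λ m′ → concatMap (λ k′ → representatives f (suc m′) k′) (upTo (suc k))) (upTo m)

  Rigid : List Tree → Set
  Rigid L = ∀ {x y} → x ∈ L → y ∈ L → x ≅ y → x ≡ y

  record Transversal (L : List Tree) (s k : ℕ) : Set where
    field
      good : All (Good s k) L
      distinct : Unique L
      rigid : Rigid L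
      complete : ∀ t → Good s k t → ∃ λ t′ → t′ ∈ L × t ≅ t′

  empty-transversal : ∀ {s k} → (∀ t → ¬ Good s k t) → Transversal [] s k
  empty-transversal none = record { good = [] ; distinct = [] ; rigid = λ () ; complete = λ t g → contradiction g (none t) }

  no-tree-without-leaves : ∀ k t → ¬ Good 0 k t
  no-tree-without-leaves k t (_ , leaves≡0 , _) = contradiction leaves≡0 (ℕₚ.>⇒≢ (1≤leaves t))

  no-inner-with-one-leaf : ∀ k t → ¬ Good 1 (suc k) t
  no-inner-with-one-leaf k (node []) (_ , _ , ())
  no-inner-with-one-leaf k (node (x ∷ [])) (() , _)
  no-inner-with-one-leaf k (node (x ∷ y ∷ xs)) (_ , leaves≡1 , _) =
    contradiction (≡.subst (2 ≤_) leaves≡1 (ℕₚ.+-mono-≤ (1≤leaves x) (ℕₚ.≤-trans (1≤leaves y) (ℕₚ.m≤m+n _ _)))) λ { (s≤s ()) }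

  no-leaves-without-inner : ∀ s t → ¬ Good (suc (suc s)) 0 t
  no-leaves-without-inner s (node []) (_ , () , _)
  no-leaves-without-inner s (node (x ∷ xs)) (_ , _ , ())

  transversal-leaf : Transversal (node [] ∷ []) 1 0
  transversal-leaf = record { good = (tt , ≡.refl , ≡.refl) ∷ [] ; distinct = [] ∷ [] ; rigid = rigid ; complete = complete }
    where
    rigid : Rigid (node [] ∷ [])
    rigid (here ≡.refl) (here ≡.refl) _ = ≡.refl
    complete : ∀ t → Good 1 0 t → ∃ λ t′ → t′ ∈ node [] ∷ [] × t ≅ t′
    complete (node []) _ = node [] , here ≡.refl , ≅-refl _
    complete (node (x ∷ xs)) (_ , _ , ())

  ∈⇒leaves≤ : ∀ {c ch} → c ∈ ch → leaves c ≤ leavesL ch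
  ∈⇒leaves≤ {c} {_ ∷ ch} (here ≡.refl) = ℕₚ.m≤m+n (leaves c) (leavesL ch)
  ∈⇒leaves≤ {c} {x ∷ ch} (there c∈) = ℕₚ.≤-trans (∈⇒leaves≤ c∈) (ℕₚ.m≤n+m (leavesL ch) (leaves x))

  ∈⇒inner≤ : ∀ {c ch} → c ∈ ch → inner c ≤ innerL ch
  ∈⇒inner≤ {c} {_ ∷ ch} (here ≡.refl) = ℕₚ.m≤m+n (inner c) (innerL ch)
  ∈⇒inner≤ {c} {x ∷ ch} (there c∈) = ℕₚ.≤-trans (∈⇒inner≤ c∈) (ℕₚ.m≤n+m (innerL ch) (inner x))

  ∈⇒leaves< : ∀ {c x y ch} → c ∈ x ∷ y ∷ ch → leaves c < leavesL (x ∷ y ∷ ch)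
  ∈⇒leaves< {c} {x} {y} {ch} (here ≡.refl) =
    ℕₚ.m<m+n (leaves c) (ℕₚ.≤-trans (1≤leaves y) (ℕₚ.m≤m+n (leaves y) (leavesL ch)))
  ∈⇒leaves< {c} {x} {y} {ch} (there c∈) = ℕₚ.≤-<-trans (∈⇒leaves≤ c∈) (ℕₚ.m<n+m (leavesL (y ∷ ch)) (1≤leaves x))

  ∈⇒seriesReduced : ∀ {xs c} → SeriesReducedL xs → c ∈ xs → SeriesReduced c
  ∈⇒seriesReduced {x ∷ xs} (x-sr , _) (here ≡.refl) = x-sr
  ∈⇒seriesReduced {x ∷ xs} (_ , xs-sr) (there c∈) = ∈⇒seriesReduced xs-sr c∈

  choose-representatives : ∀ {R ch} → All (λ c → ∃ λ r → r ∈ R × c ≅ r) ch →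
                           ∃ λ ch′ → Pointwise _≅_ ch ch′ × All (_∈ R) ch′
  choose-representatives [] = [] , [] , []
  choose-representatives ((r , r∈R , c≅r) ∷ rest) with choose-representatives rest
  ... | ch′ , ch≅ch′ , ch′⊆R = r ∷ ch′ , c≅r ∷ ch≅ch′ , r∈R ∷ ch′⊆R

  rigid-Pointwise : ∀ {R zs ms} → Rigid R → All (_∈ R) zs → All (_∈ R) ms → Pointwise _≅_ zs ms → zs ≡ ms
  rigid-Pointwise rigid [] [] [] = ≡.refl
  rigid-Pointwise rigid (z∈ ∷ zs⊆) (m∈ ∷ ms⊆) (z≅m ∷ zs≅ms) = ≡.cong₂ _∷_ (rigid z∈ m∈ z≅m) (rigid-Pointwise rigid zs⊆ ms⊆ zs≅ms)

  module Grow (f s k : ℕ) (IH : ∀ m k′ → m < suc s → Transversal (representatives f (suc m) k′) (suc m) k′) where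

    R = smallerRepresentatives f (suc s) k

    withLeaves : ℕ → List Tree
    withLeaves m = concatMap (representatives f (suc m)) (upTo (suc k))

    ∈R⁻ : ∀ {x} → x ∈ R → ∃ λ m → ∃ λ k′ → (m < suc s) × (k′ < suc k) × x ∈ representatives f (suc m) k′
    ∈R⁻ x∈ with find (∈ₚ.∈-concatMap⁻ withLeaves {upTo (suc s)} x∈)
    ... | m , m∈ , x∈′ with find (∈ₚ.∈-concatMap⁻ (representatives f (suc m)) {upTo (suc k)} x∈′)
    ...   | k′ , k′∈ , x∈″ = m , k′ , ∈ₚ.∈-upTo⁻ m∈ , ∈ₚ.∈-upTo⁻ k′∈ , x∈″

    ∈R⁺ : ∀ {x m k′} → m < suc s → k′ < suc k → x ∈ representatives f (suc m) k′ → x ∈ R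
    ∈R⁺ {m = m} m< k′< x∈ =
      ∈ₚ.∈-concatMap⁺ withLeaves (lose (∈ₚ.∈-upTo⁺ m<) (∈ₚ.∈-concatMap⁺ (representatives f (suc m)) (lose (∈ₚ.∈-upTo⁺ k′<) x∈)))

    R-good : ∀ {x} → x ∈ R → SeriesReduced x × (leaves x ≤ suc s) × (inner x ≤ k)
    R-good x∈ with ∈R⁻ x∈
    ... | m , k′ , m< , k′< , x∈′ with All.lookup (Transversal.good (IH m k′ m<)) x∈′
    ...   | x-sr , leaves≡ , inner≡ =
      x-sr , ≡.subst (_≤ suc s) (≡.sym leaves≡) m< , ≡.subst (_≤ k) (≡.sym inner≡) (ℕₚ.≤-pred k′<)

    R-unique : Unique R
    R-unique = unique-concatMap withLeaves (ℕ.pred ∘ leaves) (upTo (suc s)) (Uniqueₚ.upTo⁺ (suc s))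
      (λ {m} m∈ → unique-concatMap (representatives f (suc m)) inner (upTo (suc k)) (Uniqueₚ.upTo⁺ (suc k))
        (λ {k′} _ → Transversal.distinct (IH _ k′ (∈ₚ.∈-upTo⁻ m∈)))
        (λ {k′} _ y∈ → proj₂ (proj₂ (All.lookup (Transversal.good (IH _ k′ (∈ₚ.∈-upTo⁻ m∈))) y∈))))
      leaves-index
      where
      leaves-index : ∀ {m y} → m ∈ upTo (suc s) → y ∈ withLeaves m → ℕ.pred (leaves y) ≡ m
      leaves-index {m} m∈ y∈ with find (∈ₚ.∈-concatMap⁻ (representatives f (suc m)) {upTo (suc k)} y∈)
      ... | k′ , _ , y∈′ = ≡.cong ℕ.pred (proj₁ (proj₂ (All.lookup (Transversal.good (IH _ k′ (∈ₚ.∈-upTo⁻ m∈))) y∈′)))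

    R-rigid : Rigid R
    R-rigid x∈ y∈ x≅y with ∈R⁻ x∈ | ∈R⁻ y∈
    ... | m₁ , k₁ , m₁< , _ , x∈′ | m₂ , k₂ , m₂< , _ , y∈′
      with All.lookup (Transversal.good (IH m₁ k₁ m₁<)) x∈′ | All.lookup (Transversal.good (IH m₂ k₂ m₂<)) y∈′
    ...   | _ , leaves-x , inner-x | _ , leaves-y , inner-y
      with ℕₚ.suc-injective (≡.trans (≡.sym leaves-x) (≡.trans (≅-leaves x≅y) leaves-y))
         | ≡.trans (≡.sym inner-x) (≡.trans (≅-inner x≅y) inner-y)
    ...     | ≡.refl | ≡.refl = Transversal.rigid (IH m₁ k₁ m₁<) x∈′ y∈′ x≅y

    Children = multisets R (suc (suc s)) k

    node-good : ∀ {M} → M ∈ Children → Good (suc (suc s)) (suc k) (node M)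
    node-good {M} M∈ with multisets-sound R _ _ M∈
    node-good {[]} M∈ | _ , () , _
    node-good {x ∷ []} M∈ | x∈ ∷ [] , leaves≡ , _ =
      contradiction (≡.trans (≡.sym (ℕₚ.+-identityʳ (leaves x))) leaves≡) (ℕₚ.<⇒≢ (s≤s (proj₁ (proj₂ (R-good x∈)))))
    node-good {x ∷ y ∷ M} M∈ | M⊆R , leaves≡ , inner≡ = seriesReduced M⊆R , leaves≡ , ≡.cong suc inner≡
      where
      seriesReduced : ∀ {M} → All (_∈ R) M → SeriesReducedL M
      seriesReduced [] = tt
      seriesReduced (x∈ ∷ M⊆R) = proj₁ (R-good x∈) , seriesReduced M⊆R

    transversal : Transversal (map node Children) (suc (suc s)) (suc k)
    transversal = record { good = good ; distinct = distinct ; rigid = rigid ; complete = complete }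
      where
      good : All (Good (suc (suc s)) (suc k)) (map node Children)
      good = Allₚ.map⁺ (All.tabulate node-good)

      distinct : Unique (map node Children)
      distinct = Uniqueₚ.map⁺ node-injective (multisets-unique R R-unique (suc (suc s)) k)

      rigid : Rigid (map node Children)
      rigid t∈ u∈ t≅u with ∈ₚ.∈-map⁻ node t∈ | ∈ₚ.∈-map⁻ node u∈
      rigid t∈ u∈ (node M₁↭Z Z≅M₂) | M₁ , M₁∈ , ≡.refl | M₂ , M₂∈ , ≡.refl =
        ≡.cong node (multisets-multiplicity-injective R R-unique _ _ M₁∈ M₂∈
          (λ r → multiplicity-↭ r (≡.subst (M₁ ↭_) Z≡M₂ M₁↭Z)))
        where
        Z≡M₂ = rigid-Pointwise R-rigid (↭ₚ.All-resp-↭ M₁↭Z (proj₁ (multisets-sound R _ _ M₁∈)))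
                                       (proj₁ (multisets-sound R _ _ M₂∈)) Z≅M₂

      complete : ∀ t → Good (suc (suc s)) (suc k) t → ∃ λ t′ → t′ ∈ map node Children × t ≅ t′
      complete (node []) (_ , () , _)
      complete (node (x ∷ [])) (() , _)
      complete (node ch@(x ∷ y ∷ _)) (ch-sr , leaves≡ , inner≡)
        with choose-representatives {R} (All.tabulate representative)
        where
        representative : ∀ {c} → c ∈ ch → ∃ λ r → r ∈ R × c ≅ r
        representative {c} c∈ with leaves-suc c
        ... | m , leaves-c with ≡.subst (_< suc (suc s)) leaves-c (≡.subst (leaves c <_) leaves≡ (∈⇒leaves< c∈))
        ...   | s≤s m< with Transversal.complete (IH m (inner c) m<) c (∈⇒seriesReduced ch-sr c∈ , leaves-c , ≡.refl)
        ...     | r , r∈ , c≅r = r , ∈R⁺ m< (s≤s (≡.subst (inner c ≤_) (ℕₚ.suc-injective inner≡) (∈⇒inner≤ c∈))) r∈ , c≅r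
      ... | ch′ , ch≅ch′ , ch′⊆R with multisets-complete R ch′ ch′⊆R
      ...   | M , M∈ , ch′↭M with Pointwise-↭-commute ch≅ch′ ch′↭M
      ...     | Z , ch↭Z , Z≅M =
        node M , ∈ₚ.∈-map⁺ node (≡.subst₂ (λ u v → M ∈ multisets R u v) leaves≡′ inner≡′ M∈) , node ch↭Z Z≅M
        where
        leaves≡′ = ≡.trans (≡.sym (Pointwise-≅-leavesL ch≅ch′)) leaves≡
        inner≡′ = ≡.trans (≡.sym (Pointwise-≅-innerL ch≅ch′)) (ℕₚ.suc-injective inner≡)

  representatives-transversal : ∀ f s k → s ≤ suc f → Transversal (representatives f s k) s k
  representatives-transversal f zero k _ = empty-transversal (no-tree-without-leaves k)
  representatives-transversal f (suc zero) zero _ = transversal-leaf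
  representatives-transversal f (suc zero) (suc k) _ = empty-transversal (no-inner-with-one-leaf k)
  representatives-transversal f (suc (suc s)) zero _ = empty-transversal (no-leaves-without-inner s)
  representatives-transversal (suc f) (suc (suc s)) (suc k) (s≤s s<f) =
    Grow.transversal f s k (λ m k′ m< → representatives-transversal f (suc m) k′ (ℕₚ.≤-trans m< s<f))

  concatMap-cong-∈ : ∀ {A B : Set} (g h : A → List B) xs → (∀ {a} → a ∈ xs → g a ≡ h a) → concatMap g xs ≡ concatMap h xs
  concatMap-cong-∈ g h [] e = ≡.refl
  concatMap-cong-∈ g h (a ∷ xs) e = ≡.cong₂ _++_ (e (here ≡.refl)) (concatMap-cong-∈ g h xs (e ∘ there))

  representatives-fuel : ∀ f f′ s k → s ≤ suc f → s ≤ suc f′ → representatives f s k ≡ representatives f′ s k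
  representatives-fuel f f′ zero k _ _ = ≡.refl
  representatives-fuel f f′ (suc zero) zero _ _ = ≡.refl
  representatives-fuel f f′ (suc zero) (suc k) _ _ = ≡.refl
  representatives-fuel f f′ (suc (suc s)) zero _ _ = ≡.refl
  representatives-fuel (suc f) (suc f′) (suc (suc s)) (suc k) (s≤s s<f) (s≤s s<f′) =
    ≡.cong (λ R → map node (multisets R (suc (suc s)) k))
      (concatMap-cong-∈ _ _ (upTo (suc s)) λ m∈ → concatMap-cong-∈ _ _ (upTo (suc k)) λ {k′} _ →
        representatives-fuel f f′ _ k′ (ℕₚ.≤-trans (∈ₚ.∈-upTo⁻ m∈) s<f) (ℕₚ.≤-trans (∈ₚ.∈-upTo⁻ m∈) s<f′))

  lookup-fromList : ∀ {A : Set} (L : List A) i → Vec.lookup (Vec.fromList L) i ≡ lookup L i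
  lookup-fromList (x ∷ L) zero = ≡.refl
  lookup-fromList (x ∷ L) (suc i) = lookup-fromList L i

  lookup-injective : ∀ {A : Set} {L : List A} → Unique L → ∀ i j → lookup L i ≡ lookup L j → i ≡ j
  lookup-injective {L = x ∷ L} _ zero zero _ = ≡.refl
  lookup-injective {L = x ∷ L} (x∉L ∷ _) zero (suc j) x≡ = contradiction x≡ (All.lookup x∉L (∈ₚ.∈-lookup j))
  lookup-injective {L = x ∷ L} (x∉L ∷ _) (suc i) zero ≡x = contradiction (≡.sym ≡x) (All.lookup x∉L (∈ₚ.∈-lookup i))
  lookup-injective {L = x ∷ L} (_ ∷ L-unique) (suc i) (suc j) e = ≡.cong suc (lookup-injective L-unique i j e)

  seriesReducedCount : ℕ → ℕ → ℕ
  seriesReducedCount s k = length (representatives s s k)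

  isoClassCount : ∀ s k → IsoClassCount s k (seriesReducedCount s k)
  isoClassCount s k = Vec.fromList L ,
    (λ i → ≡.subst (Good s k) (≡.sym (lookup-fromList L i)) (All.lookup (Transversal.good T) (∈ₚ.∈-lookup i))) ,
    (λ i j i≅j → lookup-injective (Transversal.distinct T) i j
      (Transversal.rigid T (∈ₚ.∈-lookup i) (∈ₚ.∈-lookup j) (≡.subst₂ _≅_ (lookup-fromList L i) (lookup-fromList L j) i≅j))) ,
    covered
    where
    L = representatives s s k
    T = representatives-transversal s s k (ℕₚ.n≤1+n s)
    covered : ∀ t → Good s k t → Σ (Fin (length L)) λ i → t ≅ Vec.lookup (Vec.fromList L) i
    covered t t-good with Transversal.complete T t t-good
    ... | t′ , t′∈ , t≅t′ =
      Any.index t′∈ , ≡.subst (t ≅_) (≡.trans (Anyₚ.lookup-index t′∈) (≡.sym (lookup-fromList L (Any.index t′∈)))) t≅t′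

module MultisetSeries (K : ℕ) where

  open RationalSeries
  open TreeBasics
  open Multisets
  open CommutativeSemiring (𝔸 K) using (_≈_; _*_)
  module 𝔸Σ = SemiringSums (𝔸 K)
  module 𝔸S = PowerSeries (𝔸 K)
  open 𝔸Exp K using (geometricProduct)
  open import Algebra.Definitions.RawSemiring (CommutativeSemiring.rawSemiring (𝔸 K)) using (_^_)

  tPower : ℕ → PS
  tPower c = ℚS.monomial c 1ℚ

  -- a tree r contributes the factor 1 / (1 - t^(inner r) x^(leaves r))
  geometricFactors : List Tree → List (ℕ × PS)
  geometricFactors = map (λ r → ℕ.pred (leaves r) , tPower (inner r))

  multisetCount : List Tree → ℕ → PS
  multisetCount R n q = fromℕ (length (multisets R n q))

  𝔸Σ<-at : ∀ n (F : ℕ → PS) q → 𝔸Σ.Σ< n F q ≡ ℚΣ.Σ< n (λ a → F a q)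
  𝔸Σ<-at zero F q = ≡.refl
  𝔸Σ<-at (suc n) F q = ≡.cong (F 0 q ℚ.+_) (𝔸Σ<-at n (F ∘ suc) q)

  𝔸when-at : ∀ b X q → 𝔸Σ.when b X q ≡ ℚΣ.when b (X q)
  𝔸when-at true X q = ≡.refl
  𝔸when-at false X q = ≡.refl

  tPower-⊠ : ∀ c (C : PS) q → (tPower c ℚS.⊠ C) q ≡ ℚΣ.when (c ≤ᵇ q) (C (q ∸ c))
  tPower-⊠ c C q with c ≤ᵇ q | ℚS.monomial-⊠ c 1ℚ C q
  ... | true | eq = ≡.trans eq (ℚₚ.*-identityˡ _)
  ... | false | eq = eq

  tPower-+ : ∀ c d q → ℚΣ.when (c ≤ᵇ q) (tPower d (q ∸ c)) ≡ tPower (c ℕ.+ d) q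
  tPower-+ zero d q = ≡.refl
  tPower-+ (suc c) d zero = ≡.refl
  tPower-+ (suc c) d (suc q) = ≡.trans (ℚΣ.when-≤ᵇ-suc c q (tPower d (q ∸ c))) (tPower-+ c d q)

  tPower-^ : ∀ c a q → (tPower c ^ a) q ≡ tPower (a ℕ.* c) q
  tPower-^ c zero zero = ≡.refl
  tPower-^ c zero (suc q) = ≡.refl
  tPower-^ c (suc a) q = begin
    (tPower c ℚS.⊠ tPower c ^ a) q               ≡⟨ ℚS.⊠-cong (λ _ → ≡.refl) (tPower-^ c a) q ⟩
    (tPower c ℚS.⊠ tPower (a ℕ.* c)) q           ≡⟨ tPower-⊠ c (tPower (a ℕ.* c)) q ⟩
    ℚΣ.when (c ≤ᵇ q) (tPower (a ℕ.* c) (q ∸ c))  ≡⟨ tPower-+ c (a ℕ.* c) q ⟩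
    tPower (suc a ℕ.* c) q                       ∎
    where open ≡.≡-Reasoning

  -- Choosing a copies of r, with a (leaves r) ≤ n, is the a-th term of the geometric series.
  geometricProduct≈multisetCount : ∀ R n → geometricProduct (geometricFactors R) n ≈ multisetCount R n
  geometricProduct≈multisetCount [] zero = ℚS.mk≈ λ { zero _ → ≡.refl ; (suc q) _ → ≡.refl }
  geometricProduct≈multisetCount [] (suc n) = ℚS.mk≈ λ _ _ → ≡.refl
  geometricProduct≈multisetCount (r ∷ R) n = ℚS.mk≈ λ q q≤K → ≡.trans (ℚS.get≈ expand q q≤K) (≡.sym (count q))
    where
    m = ℕ.pred (leaves r)
    leaves≡ : leaves r ≡ suc m
    leaves≡ = ≡.sym (ℕₚ.suc-pred (leaves r) {{ℕ.>-nonZero (1≤leaves r)}})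
    U = tPower (inner r)
    T : ℕ → PS
    T a = 𝔸Σ.when (a ℕ.* suc m ≤ᵇ n) ((U ^ a) * multisetCount R (n ∸ a ℕ.* suc m))
    expand : geometricProduct (geometricFactors (r ∷ R)) n ≈ 𝔸Σ.Σ< (suc n) T
    expand = CommutativeSemiring.trans (𝔸 K)
      (𝔸S.⊠-cong (λ _ → CommutativeSemiring.refl (𝔸 K)) (geometricProduct≈multisetCount R) n)
      (𝔸S.dilate-⊠ m 0 (U ^_) (multisetCount R) n (suc n) ℕₚ.≤-refl)
    term : ∀ q a → fromℕ (ℕΣ.when (fits r n q a) (length (multisets R (n ∸ a ℕ.* leaves r) (q ∸ a ℕ.* inner r))))
                   ≡ T a q
    term q a = begin
      fromℕ (ℕΣ.when (fits r n q a) (length (multisets R (n ∸ a ℕ.* leaves r) (q ∸ a ℕ.* inner r))))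
        ≡⟨ fromℕ-when (fits r n q a) _ ⟩
      ℚΣ.when (fits r n q a) (multisetCount R (n ∸ a ℕ.* leaves r) (q ∸ a ℕ.* inner r))
        ≡⟨ ℚΣ.when-∧ (a ℕ.* leaves r ≤ᵇ n) (a ℕ.* inner r ≤ᵇ q) _ ⟩
      ℚΣ.when (a ℕ.* leaves r ≤ᵇ n) (ℚΣ.when (a ℕ.* inner r ≤ᵇ q) (multisetCount R (n ∸ a ℕ.* leaves r) (q ∸ a ℕ.* inner r)))
        ≡⟨ ≡.cong (λ L → ℚΣ.when (a ℕ.* L ≤ᵇ n) (ℚΣ.when (a ℕ.* inner r ≤ᵇ q) (multisetCount R (n ∸ a ℕ.* L) (q ∸ a ℕ.* inner r)))) leaves≡ ⟩
      ℚΣ.when (a ℕ.* suc m ≤ᵇ n) (ℚΣ.when (a ℕ.* inner r ≤ᵇ q) (multisetCount R (n ∸ a ℕ.* suc m) (q ∸ a ℕ.* inner r)))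
        ≡⟨ ≡.cong (ℚΣ.when (a ℕ.* suc m ≤ᵇ n)) (≡.sym (tPower-⊠ (a ℕ.* inner r) _ q)) ⟩
      ℚΣ.when (a ℕ.* suc m ≤ᵇ n) ((tPower (a ℕ.* inner r) ℚS.⊠ multisetCount R (n ∸ a ℕ.* suc m)) q)
        ≡⟨ ≡.cong (ℚΣ.when (a ℕ.* suc m ≤ᵇ n)) (ℚS.⊠-cong (λ q → ≡.sym (tPower-^ (inner r) a q)) (λ _ → ≡.refl) q) ⟩
      ℚΣ.when (a ℕ.* suc m ≤ᵇ n) (((U ^ a) * multisetCount R (n ∸ a ℕ.* suc m)) q)
        ≡⟨ ≡.sym (𝔸when-at (a ℕ.* suc m ≤ᵇ n) _ q) ⟩
      T a q ∎
      where open ≡.≡-Reasoning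
    count : ∀ q → multisetCount (r ∷ R) n q ≡ 𝔸Σ.Σ< (suc n) T q
    count q = ≡.trans (≡.cong fromℕ (length-multisets-∷ r R n q))
      (≡.trans (fromℕ-Σ< (suc n) (λ a → ℕΣ.when (fits r n q a)
                 (length (multisets R (n ∸ a ℕ.* leaves r) (q ∸ a ℕ.* inner r))))) (≡.trans (ℚΣ.Σ<-cong (suc n) (λ a _ → term q a)) (≡.sym (𝔸Σ<-at (suc n) T q))))

countWhere : ∀ {A : Set} → (A → Bool) → List A → ℕ
countWhere p [] = 0
countWhere p (x ∷ xs) = ℕΣ.when (p x) 1 ℕ.+ countWhere p xs

module _ {A : Set} where

  countWhere-cong : ∀ {p p′ : A → Bool} xs → (∀ x → p x ≡ p′ x) → countWhere p xs ≡ countWhere p′ xs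
  countWhere-cong [] e = ≡.refl
  countWhere-cong (x ∷ xs) e = ≡.cong₂ ℕ._+_ (≡.cong (λ b → ℕΣ.when b 1) (e x)) (countWhere-cong xs e)

  countWhere-false : ∀ (xs : List A) → countWhere (λ _ → false) xs ≡ 0
  countWhere-false [] = ≡.refl
  countWhere-false (x ∷ xs) = countWhere-false xs

  countWhere-++ : ∀ (p : A → Bool) xs ys → countWhere p (xs ++ ys) ≡ countWhere p xs ℕ.+ countWhere p ys
  countWhere-++ p [] ys = ≡.refl
  countWhere-++ p (x ∷ xs) ys = ≡.trans (≡.cong (ℕΣ.when (p x) 1 ℕ.+_) (countWhere-++ p xs ys)) (≡.sym (ℕₚ.+-assoc (ℕΣ.when (p x) 1) (countWhere p xs) (countWhere p ys)))

  countWhere-concatMap : ∀ (p : A → Bool) (g : ℕ → List A) n → countWhere p (concatMap g (upTo n)) ≡ ℕΣ.Σ< n (countWhere p ∘ g)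
  countWhere-concatMap p g n = go n (λ a → a)
    where
    go : ∀ n h → countWhere p (concatMap g (applyUpTo h n)) ≡ ℕΣ.Σ< n (countWhere p ∘ g ∘ h)
    go zero h = ≡.refl
    go (suc n) h = ≡.trans (countWhere-++ p (g (h 0)) _) (≡.cong (countWhere p (g (h 0)) ℕ.+_) (go n (h ∘ suc)))

  countWhere-constant : ∀ (p : A → Bool) b xs → All (λ x → p x ≡ b) xs → countWhere p xs ≡ ℕΣ.when b (length xs)
  countWhere-constant p true [] [] = ≡.refl
  countWhere-constant p false [] [] = ≡.refl
  countWhere-constant p b (x ∷ xs) (px≡b ∷ rest) rewrite px≡b | countWhere-constant p b xs rest with b
  ... | true = ≡.refl
  ... | false = ≡.refl

module BellArguments (s″ K : ℕ) where

  open RationalFacts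
  open RationalSeries
  open TreeBasics
  open Representatives
  open MultisetSeries K using (tPower; tPower-^; geometricFactors; 𝔸Σ<-at; 𝔸when-at)
  open 𝔸Exp K using (logCoeff)
  open BellExpansion K using (rescaled)
  open CommutativeSemiring (𝔸 K) using (_≈_)

  s = suc (suc s″)
  R = smallerRepresentatives (suc s″) (suc s″) K

  -- the d-th power of the geometric factor of r contributes to the coefficient of x^i t^q
  contributes : ℕ → ℕ → ℕ → Tree → Bool
  contributes i q d r = (i ≡ᵇ suc d ℕ.* leaves r) ∧ (q ≡ᵇ suc d ℕ.* inner r)

  logCoeff-at : ∀ N i q L →
    logCoeff N (geometricFactors L) i q ≡ ℚΣ.Σ< N (λ d → 1/suc d ℚ.* fromℕ (countWhere (contributes i q d) L))
  logCoeff-at N i q [] = ≡.sym (ℚΣ.Σ<-zero N (λ d _ → ℚₚ.*-zeroʳ (1/suc d)))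
  logCoeff-at N i q (r ∷ L) = begin
    𝔸Σ.Σ< N F q ℚ.+ logCoeff N (geometricFactors L) i q
      ≡⟨ ≡.cong₂ ℚ._+_ (≡.trans (𝔸Σ<-at N F q) (ℚΣ.Σ<-cong N (λ d _ → term d))) (logCoeff-at N i q L) ⟩
    ℚΣ.Σ< N (λ d → 1/suc d ℚ.* fromℕ (own d)) ℚ.+ ℚΣ.Σ< N (λ d → 1/suc d ℚ.* fromℕ (countWhere (contributes i q d) L))
      ≡⟨ ≡.sym (ℚΣ.Σ<-+ N _ _) ⟩
    ℚΣ.Σ< N (λ d → 1/suc d ℚ.* fromℕ (own d) ℚ.+ 1/suc d ℚ.* fromℕ (countWhere (contributes i q d) L))
      ≡⟨ ℚΣ.Σ<-cong N (λ d _ → ≡.trans (≡.sym (ℚₚ.*-distribˡ-+ (1/suc d) _ _)) (≡.cong (1/suc d ℚ.*_) (≡.sym (fromℕ-+ (own d) _)))) ⟩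
    ℚΣ.Σ< N (λ d → 1/suc d ℚ.* fromℕ (countWhere (contributes i q d) (r ∷ L))) ∎
    where
    open ≡.≡-Reasoning
    module 𝔸Σ = SemiringSums (𝔸 K)
    open import Algebra.Definitions.RawSemiring (CommutativeSemiring.rawSemiring (𝔸 K)) using (_^_)
    m = ℕ.pred (leaves r)
    leaves≡ : suc m ≡ leaves r
    leaves≡ = ℕₚ.suc-pred (leaves r) {{ℕ.>-nonZero (1≤leaves r)}}
    F = λ d → 𝔸Σ.when (i ≡ᵇ suc d ℕ.* suc m) (CommutativeSemiring._*_ (𝔸 K) (tPower (inner r) ^ suc d) (const (1/suc d)))
    own = λ d → ℕΣ.when (contributes i q d r) 1
    term : ∀ d → F d q ≡ 1/suc d ℚ.* fromℕ (own d)
    term d = begin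
      F d q ≡⟨ 𝔸when-at (i ≡ᵇ suc d ℕ.* suc m) _ q ⟩
      ℚΣ.when (i ≡ᵇ suc d ℕ.* suc m) ((tPower (inner r) ^ suc d ℚS.⊠ const (1/suc d)) q)
        ≡⟨ ≡.cong₂ (λ L v → ℚΣ.when (i ≡ᵇ suc d ℕ.* L) v) leaves≡
             (≡.trans (⊠-const (1/suc d) _ q) (≡.cong (1/suc d ℚ.*_) (≡.trans (tPower-^ (inner r) (suc d) q)
               (ℚS.monomial-coeff (suc d ℕ.* inner r) 1ℚ q)))) ⟩
      ℚΣ.when (i ≡ᵇ suc d ℕ.* leaves r) (1/suc d ℚ.* ℚΣ.when (q ≡ᵇ suc d ℕ.* inner r) 1ℚ)
        ≡⟨ combine (i ≡ᵇ suc d ℕ.* leaves r) (q ≡ᵇ suc d ℕ.* inner r) ⟩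
      1/suc d ℚ.* fromℕ (own d) ∎
      where
      combine : ∀ b c → ℚΣ.when b (1/suc d ℚ.* ℚΣ.when c 1ℚ) ≡ 1/suc d ℚ.* fromℕ (ℕΣ.when (b ∧ c) 1)
      combine true true = ≡.refl
      combine true false = ≡.refl
      combine false c = ≡.sym (ℚₚ.*-zeroʳ (1/suc d))

  -- R holds the representatives with fewer than s leaves: every class of size m ≠ s once.
  countWhere-size : ∀ m q′ → 1 ≤ m → m ≤ s → q′ ≤ K →
    countWhere (λ r → (leaves r ≡ᵇ m) ∧ (inner r ≡ᵇ q′)) R ≡ ℕΣ.when (not (m ≡ᵇ s)) (seriesReducedCount m q′)
  countWhere-size (suc m₀) q′ _ m≤s q′≤K = begin
    countWhere p R
      ≡⟨ countWhere-concatMap p (λ m′ → concatMap (block m′) (upTo (suc K))) (suc s″) ⟩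
    ℕΣ.Σ< (suc s″) (λ m′ → countWhere p (concatMap (block m′) (upTo (suc K))))
      ≡⟨ ℕΣ.Σ<-cong (suc s″) (λ m′ m′< → ≡.trans (countWhere-concatMap p (block m′) (suc K))
           (≡.trans (ℕΣ.Σ<-cong (suc K) (λ k′ _ → ≡.trans (countWhere-constant p ((m′ ≡ᵇ m₀) ∧ (k′ ≡ᵇ q′)) (block m′ k′) (sized m′ k′ m′<))
              (ℕΣ.when-∧ (m′ ≡ᵇ m₀) (k′ ≡ᵇ q′) (length (block m′ k′)))))
             (ℕΣ.Σ<-when (suc K) (m′ ≡ᵇ m₀) (λ k′ → ℕΣ.when (k′ ≡ᵇ q′) (length (block m′ k′)))))) ⟩
    ℕΣ.Σ< (suc s″) (λ m′ → ℕΣ.when (m′ ≡ᵇ m₀) (ℕΣ.Σ< (suc K) (λ k′ → ℕΣ.when (k′ ≡ᵇ q′) (length (block m′ k′)))))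
      ≡⟨ ℕΣ.Σ<-cong (suc s″) (λ m′ _ → ≡.cong (ℕΣ.when (m′ ≡ᵇ m₀))
           (≡.trans (ℕΣ.Σ<-delta (suc K) q′ (length ∘ block m′)) (≡.cong (λ b → ℕΣ.when b (length (block m′ q′))) (≤ᵇ-true (s≤s q′≤K))))) ⟩
    ℕΣ.Σ< (suc s″) (λ m′ → ℕΣ.when (m′ ≡ᵇ m₀) (length (block m′ q′)))
      ≡⟨ ℕΣ.Σ<-delta (suc s″) m₀ (λ m′ → length (block m′ q′)) ⟩
    ℕΣ.when (m₀ ℕ.<ᵇ suc s″) (length (block m₀ q′))
      ≡⟨ ≡.cong₂ ℕΣ.when (<ᵇ≡not≡ᵇ (ℕₚ.≤-pred m≤s))
           (≡.cong length (representatives-fuel (suc s″) (suc m₀) (suc m₀) q′ m≤s (ℕₚ.n≤1+n _))) ⟩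
    ℕΣ.when (not (suc m₀ ≡ᵇ s)) (seriesReducedCount (suc m₀) q′) ∎
    where
    open ≡.≡-Reasoning
    p = λ r → (leaves r ≡ᵇ suc m₀) ∧ (inner r ≡ᵇ q′)
    block = λ m′ k′ → representatives (suc s″) (suc m′) k′
    sized : ∀ m′ k′ → m′ < suc s″ → All (λ r → p r ≡ ((m′ ≡ᵇ m₀) ∧ (k′ ≡ᵇ q′))) (block m′ k′)
    sized m′ k′ m′< = All.map (λ { (_ , leaves≡ , inner≡) →
        ≡.cong₂ (λ u v → (u ≡ᵇ suc m₀) ∧ (v ≡ᵇ q′)) leaves≡ inner≡ })
      (Transversal.good (representatives-transversal (suc s″) (suc m′) k′ (ℕₚ.m≤n⇒m≤1+n m′<)))


  module _ (i : ℕ) (1≤i : 1 ≤ i) (i≤s : i ≤ s) (q : ℕ) (q≤K : q ≤ K) where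

    -- the term of bellArg with divisor d + 1, at t^q
    divisorTerm≡count : ∀ d (∣i? : Dec (suc d ∣ i)) (∣q? : Dec (suc d ∣ q)) →
      ℚΣ.when (does ∣i? ∧ not ((i / suc d) ≡ᵇ s))
        (1/suc d ℚ.* (if does ∣q? then abar seriesReducedCount (i / suc d) (q / suc d) else 0ℚ))
      ≡ 1/suc d ℚ.* fromℕ (countWhere (contributes i q d) R)
    divisorTerm≡count d (no ∤i) _ = ≡.sym (≡.trans (≡.cong (λ n → 1/suc d ℚ.* fromℕ n)
      (≡.trans (countWhere-cong R (λ r → ≡.cong (_∧ (q ≡ᵇ suc d ℕ.* inner r)) (≡ᵇ-*-nondivisor d (leaves r) ∤i))) (countWhere-false R)))
      (ℚₚ.*-zeroʳ (1/suc d)))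
    divisorTerm≡count d (yes ∣i) (no ∤q) = ≡.trans (vanish (not ((i / suc d) ≡ᵇ s))) (≡.sym (≡.trans (≡.cong (λ n → 1/suc d ℚ.* fromℕ n)
      (≡.trans (countWhere-cong R (λ r → ≡.trans (≡.cong ((i ≡ᵇ suc d ℕ.* leaves r) ∧_) (≡ᵇ-*-nondivisor d (inner r) ∤q))
                                            (Boolₚ.∧-zeroʳ (i ≡ᵇ suc d ℕ.* leaves r))))
        (countWhere-false R)))
      (ℚₚ.*-zeroʳ (1/suc d))))
      where
      vanish : ∀ b → ℚΣ.when b (1/suc d ℚ.* 0ℚ) ≡ 0ℚ
      vanish true = ℚₚ.*-zeroʳ (1/suc d)
      vanish false = ≡.refl
    divisorTerm≡count d (yes ∣i) (yes ∣q) = ≡.sym (begin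
      1/suc d ℚ.* fromℕ (countWhere (contributes i q d) R)
        ≡⟨ ≡.cong (λ n → 1/suc d ℚ.* fromℕ n) (countWhere-cong R (λ r →
             ≡.cong₂ _∧_ (≡ᵇ-*-divisor d (leaves r) ∣i) (≡ᵇ-*-divisor d (inner r) ∣q))) ⟩
      1/suc d ℚ.* fromℕ (countWhere (λ r → (leaves r ≡ᵇ i / suc d) ∧ (inner r ≡ᵇ q / suc d)) R)
        ≡⟨ ≡.cong (λ n → 1/suc d ℚ.* fromℕ n) (countWhere-size (i / suc d) (q / suc d) (1≤quotient 1≤i ∣i)
             (ℕₚ.≤-trans (DivMod.m/n≤m i (suc d)) i≤s) (ℕₚ.≤-trans (DivMod.m/n≤m q (suc d)) q≤K)) ⟩
      1/suc d ℚ.* fromℕ (ℕΣ.when (not ((i / suc d) ≡ᵇ s)) (seriesReducedCount (i / suc d) (q / suc d)))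
        ≡⟨ ≡.cong (1/suc d ℚ.*_) (fromℕ-when (not ((i / suc d) ≡ᵇ s)) (seriesReducedCount (i / suc d) (q / suc d))) ⟩
      1/suc d ℚ.* ℚΣ.when (not ((i / suc d) ≡ᵇ s)) (fromℕ (seriesReducedCount (i / suc d) (q / suc d)))
        ≡⟨ ℚΣ.*-when (not ((i / suc d) ≡ᵇ s)) (1/suc d) (fromℕ (seriesReducedCount (i / suc d) (q / suc d))) ⟩
      ℚΣ.when (not ((i / suc d) ≡ᵇ s)) (1/suc d ℚ.* abar seriesReducedCount (i / suc d) (q / suc d)) ∎)
      where open ≡.≡-Reasoning

    rescaled-bellArg-at : rescaled (bellArg seriesReducedCount s) i q ≡ logCoeff s (geometricFactors R) i q
    rescaled-bellArg-at = begin
      invFact i ℚ.* (fromℕ (i !) ℚ.* sumPS (map G (upTo i)) q)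
        ≡⟨ ≡.trans (≡.sym (ℚₚ.*-assoc (invFact i) (fromℕ (i !)) Σq))
             (≡.trans (≡.cong (ℚ._* Σq) (invFact*fromℕ! i)) (ℚₚ.*-identityˡ Σq)) ⟩
      sumPS (map G (upTo i)) q              ≡⟨ sumPS-at G i (λ e → e) q ⟩
      ℚΣ.Σ< i (λ e → G e q)                 ≡⟨ ℚΣ.Σ<-truncate i s (λ e → G e q) i≤s vanish ⟨
      ℚΣ.Σ< s (λ e → G e q)                 ≡⟨ ℚΣ.Σ<-cong s (λ d _ → ≡.trans (if-at (does (suc d ∣? i) ∧ not ((i / suc d) ≡ᵇ s))
                                                          (scale (1/suc d) (substPow d (abar seriesReducedCount (i / suc d)))) q)
                                                        (divisorTerm≡count d (suc d ∣? i) (suc d ∣? q))) ⟩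
      ℚΣ.Σ< s (λ d → 1/suc d ℚ.* fromℕ (countWhere (contributes i q d) R)) ≡⟨ logCoeff-at s i q R ⟨
      logCoeff s (geometricFactors R) i q   ∎
      where
      open ≡.≡-Reasoning
      G : ℕ → PS
      G e = if does (suc e ∣? i) ∧ not ((i / suc e) ≡ᵇ s)
              then scale (1/suc e) (substPow e (abar seriesReducedCount (i / suc e))) else zeroPS
      Σq = sumPS (map G (upTo i)) q
      vanish : ∀ e → i ≤ e → e < s → G e q ≡ 0ℚ
      vanish e i≤e _ rewrite dec-false (suc e ∣? i) (λ ∣i → ℕₚ.<⇒≱ (s≤s i≤e) (∣⇒≤ {{ℕ.>-nonZero 1≤i}} ∣i)) = ≡.refl

  rescaled-bellArg≈logCoeff : ∀ i → 1 ≤ i → i ≤ s → rescaled (bellArg seriesReducedCount s) i ≈ logCoeff s (geometricFactors R) i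
  rescaled-bellArg≈logCoeff i 1≤i i≤s = ℚS.mk≈ (rescaled-bellArg-at i 1≤i i≤s)

open RationalSeries
open Representatives using (seriesReducedCount; isoClassCount; smallerRepresentatives)

abar-1 : ∀ k → abar seriesReducedCount 1 k ≡ onePS k
abar-1 zero = ≡.refl
abar-1 (suc k) = ≡.refl

bellSeries : ℕ → PS
bellSeries s = scale (invFact s) (sumPS (map (λ j → Bell s j (bellArg seriesReducedCount s)) (map suc (upTo s))))

recRHS-coeff : ∀ s k → recRHS seriesReducedCount s k ≡ ℚΣ.when (1 ≤ᵇ k) (ℚ.1ℚ ℚ.* bellSeries s (k ∸ 1))
recRHS-coeff s k = ≡.trans (⊗≡⊠ tPS (bellSeries s) k)
  (≡.trans (ℚS.⊠-cong tPS≡monomial (λ _ → ≡.refl) k) (ℚS.monomial-⊠ 1 ℚ.1ℚ (bellSeries s) k))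

-- A tree with s ≥ 2 leaves and K + 1 inner vertices is a root over a multiset of smaller representatives.
seriesReducedCount-recursion : ∀ s → 2 ≤ s → ∀ k → abar seriesReducedCount s k ≡ recRHS seriesReducedCount s k
seriesReducedCount-recursion (suc zero) (s≤s ()) k
seriesReducedCount-recursion (suc (suc s″)) _ zero = ≡.sym (recRHS-coeff (suc (suc s″)) zero)
seriesReducedCount-recursion (suc (suc s″)) _ (suc K) =
  ≡.trans children (≡.sym (≡.trans (recRHS-coeff s (suc K)) (ℚₚ.*-identityˡ (bellSeries s K))))
  where
  open MultisetSeries K using (geometricFactors; multisetCount; geometricProduct≈multisetCount)
  open 𝔸Exp K using (geometricProduct≈expProduct)
  open BellExpansion K using (rescaled; Bell≈expProduct)
  open BellArguments s″ K using (rescaled-bellArg≈logCoeff)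
  s = suc (suc s″)
  R = smallerRepresentatives (suc s″) (suc s″) K
  children : abar seriesReducedCount s (suc K) ≡ bellSeries s K
  children = begin
    abar seriesReducedCount s (suc K)             ≡⟨ ≡.cong fromℕ (Listₚ.length-map Tree.node (Multisets.multisets R s K)) ⟩
    multisetCount R s K                           ≡⟨ ℚS.get≈ (geometricProduct≈multisetCount R s) K ℕₚ.≤-refl ⟨
    𝔸Exp.geometricProduct K (geometricFactors R) s K
      ≡⟨ ℚS.get≈ (geometricProduct≈expProduct s (geometricFactors R) (rescaled (bellArg seriesReducedCount s))
                    rescaled-bellArg≈logCoeff s ℕₚ.≤-refl) K ℕₚ.≤-refl ⟩
    𝔸Exp.expProduct K (rescaled (bellArg seriesReducedCount s)) 0 s s K
      ≡⟨ ℚS.get≈ (Bell≈expProduct (bellArg seriesReducedCount s) s (s≤s z≤n)) K ℕₚ.≤-refl ⟨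
    bellSeries s K                                ∎
    where open ≡.≡-Reasoning

mainTheorem9 : Σ (ℕ → ℕ → ℕ) λ a →
    ((s k : ℕ) → IsoClassCount s k (a s k)) ×
    ((k : ℕ) → abar a 1 k ≡ onePS k) ×
    ((s : ℕ) → 2 ≤ s → (k : ℕ) → abar a s k ≡ recRHS a s k)
mainTheorem9 = seriesReducedCount , isoClassCount , abar-1 , seriesReducedCount-recursion
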